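{- Let $\lambda/\mu$ be a skew shape, $m$ a positive integer, $i\in[m-1]$, and $T$ a reverse plane partition of shape $\lambda/\mu$ with entries in $[m]$. Then $F_i(r(T))=r(f_i(T))$. In particular, $f_i(T)=0$ if and only if $F_i(r(T))=0$ (with the convention $r(0)=0$).
   Context: Skew shapes are drawn in matrix coordinates (row index increases downward). A reverse plane partition of shape $\lambda/\mu$ with entries in $[m]=\{1,\dots,m\}$ is a filling weakly increasing along rows and down columns. The reading word $r(T)$: ignore every entry equal to the entry directly below it; read the remaining entries row by row from the bottom row to the top row, each row left to right. Operators on words: for a word $s$ over $[m]$, label each letter $i$ as a closing parenthesis and each letter $i+1$ as an opening parenthesis, ignore other letters, and match parentheses in the usual way. $F_i(s)$ replaces the letter $i$ corresponding to the rightmost unmatched closing parenthesis by $i+1$ (and $F_i(s)=0$ if there is none); $E_i(s)$ replaces the letter $i+1$ corresponding to the leftmost unmatched opening parenthesis by $i$ (and $E_i(s)=0$ if there is none). Operators on reverse plane partitions: in the sub-filling of $T$ consisting of entries $i$ and $i+1$, a column is $i$-pure if it contains $i$ but not $i+1$, $(i+1)$-pure if it contains $i+1$ but not $i$, mixed if it contains both. A filling is a benign tableau if it weakly increases in columns and for any two mixed columns $A$ left of $B$, the lowest $i$ in $A$ is not higher than the lowest $i$ in $B$. A descent is a box with $i+1$ whose right neighbor contains $i$; with $A$, $A+1$ their columns, the descent-resolution step changes only the $i$/$(i+1)$ entries of these columns: if $A$ is mixed and $A+1$ $i$-pure, $A$ becomes $i$-pure and $A+1$ mixed with its lowest $i$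 in the same row as the old lowest $i$ of $A$; if $A$ is $(i+1)$-pure and $A+1$ mixed, $A$ becomes mixed and $A+1$ $(i+1)$-pure, keeping the row of the lowest $i$ of the mixed column; if $A$ is $(i+1)$-pure and $A+1$ $i$-pure, swap $i\leftrightarrow i+1$ in both columns. The descent-resolution algorithm applies steps until no descent remains, yielding a reverse plane partition independent of the order of steps. To define $e_i,f_i$: label $i$-pure columns by closing and $(i+1)$-pure columns by opening parentheses (left to right, mixed columns ignored) and match. $f_i(T)$: take the $i$-pure column of the rightmost unmatched closing parenthesis (if none, $f_i(T)=0$), change its $i$'s to $i+1$'s, then apply the descent-resolution algorithm. $e_i(T)$: take the $(i+1)$-pure column of the leftmost unmatched opening parenthesis (if none, $e_i(T)=0$), change its $i+1$'s to $i$'s, then apply the descent-resolution algorithm. -}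

module Defs where

open import Data.Nat using (ℕ; zero; suc; _+_; _∸_; _≤_; _<_; _≤ᵇ_; _<ᵇ_; _≡ᵇ_)
open import Data.Bool using (Bool; true; false; _∧_; _∨_; not; if_then_else_)
open import Data.List using (List; []; _∷_; length; map; upTo; downFrom; concatMap; last)
open import Data.Bool.ListAction using (any)
open import Data.Maybe using (Maybe; just; nothing)
open import Data.Product using (_×_)
open import Relation.Nullary using (¬_)
open import Relation.Binary.PropositionalEquality using (_≡_)
open import Relation.Binary.Construct.Closure.ReflexiveTransitive using (Star)

-- Shapes (matrix coordinates: row r, column c, both 0-based)

at : List ℕ → ℕ → ℕ
at []       _       = 0
at (x ∷ xs) zero    = x
at (x ∷ xs) (suc n) = at xs n

Partition : List ℕ → Set
Partition xs = ∀ j → at xs (suc j) ≤ at xs j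

SkewShape : List ℕ → List ℕ → Set
SkewShape la mu = Partition la × Partition mu × (∀ j → at mu j ≤ at la j)

InShape : List ℕ → List ℕ → ℕ → ℕ → Set
InShape la mu r c = at mu r ≤ c × c < at la r

inShapeᵇ : List ℕ → List ℕ → ℕ → ℕ → Bool
inShapeᵇ la mu r c = (at mu r ≤ᵇ c) ∧ (c <ᵇ at la r)

-- a filling: entry in row r, column c (only the cells of the shape matter)
Filling : Set
Filling = ℕ → ℕ → ℕ

RPP : List ℕ → List ℕ → ℕ → Filling → Set
RPP la mu m T =
  (∀ r c → InShape la mu r c → 1 ≤ T r c × T r c ≤ m) ×
  (∀ r c → InShape la mu r c → InShape la mu r (suc c) → T r c ≤ T r (suc c)) ×
  (∀ r c → InShape la mu r c → InShape la mu (suc r) c → T r c ≤ T (suc r) c)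

readRow : List ℕ → List ℕ → Filling → ℕ → List ℕ
readRow la mu T r = concatMap cell (map (at mu r +_) (upTo (at la r ∸ at mu r)))
  where
  cell : ℕ → List ℕ
  cell c = if inShapeᵇ la mu (suc r) c ∧ (T (suc r) c ≡ᵇ T r c) then [] else (T r c ∷ [])

reading : List ℕ → List ℕ → Filling → List ℕ
reading la mu T = concatMap (readRow la mu T) (downFrom (length la))

data Paren : Set where
  opn cls non : Paren

-- positions of unmatched closing parentheses
-- (k = number of currently unmatched opening ones, p = current position)
unmatchedCls : ℕ → ℕ → List Paren → List ℕ
unmatchedCls k       p []           = []
unmatchedCls k       p (opn ∷ xs)   = unmatchedCls (suc k) (suc p) xs
unmatchedCls zero    p (cls ∷ xs)   = p ∷ unmatchedCls zero (suc p) xs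
unmatchedCls (suc k) p (cls ∷ xs)   = unmatchedCls k (suc p) xs
unmatchedCls k       p (non ∷ xs)   = unmatchedCls k (suc p) xs

rightmostUnmatchedCls : List Paren → Maybe ℕ
rightmostUnmatchedCls ps = last (unmatchedCls 0 0 ps)

-- F_i on words (nothing = 0)

setAt : ℕ → ℕ → List ℕ → List ℕ
setAt p v []            = []
setAt zero v (x ∷ xs)   = v ∷ xs
setAt (suc p) v (x ∷ xs) = x ∷ setAt p v xs

letterParen : ℕ → ℕ → Paren
letterParen i x = if x ≡ᵇ i then cls else (if x ≡ᵇ suc i then opn else non)

Fword : ℕ → List ℕ → Maybe (List ℕ)
Fword i w with rightmostUnmatchedCls (map (letterParen i) w)
... | nothing = nothing
... | just p  = just (setAt p (suc i) w)

hasVal : List ℕ → List ℕ → Filling → ℕ → ℕ → Bool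
hasVal la mu T c v = any (λ r → inShapeᵇ la mu r c ∧ (T r c ≡ᵇ v)) (upTo (length la))

iPure opPure mixed : List ℕ → List ℕ → ℕ → Filling → ℕ → Bool
iPure  la mu i T c = hasVal la mu T c i ∧ not (hasVal la mu T c (suc i))
opPure la mu i T c = not (hasVal la mu T c i) ∧ hasVal la mu T c (suc i)
mixed  la mu i T c = hasVal la mu T c i ∧ hasVal la mu T c (suc i)

colParen : List ℕ → List ℕ → ℕ → Filling → ℕ → Paren
colParen la mu i T c =
  if iPure la mu i T c then cls else (if opPure la mu i T c then opn else non)

colWord : List ℕ → List ℕ → ℕ → Filling → List Paren
colWord la mu i T = map (colParen la mu i T) (upTo (at la 0))

isIorI1 : ℕ → ℕ → Bool
isIorI1 i x = (x ≡ᵇ i) ∨ (x ≡ᵇ suc i)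

raise : List ℕ → List ℕ → ℕ → ℕ → Filling → Filling
raise la mu i c T r c' =
  if (c' ≡ᵇ c) ∧ inShapeᵇ la mu r c' ∧ (T r c' ≡ᵇ i) then suc i else T r c'

setColAll : List ℕ → List ℕ → ℕ → ℕ → ℕ → Filling → Filling
setColAll la mu i c v T r c' =
  if (c' ≡ᵇ c) ∧ inShapeᵇ la mu r c' ∧ isIorI1 i (T r c') then v else T r c'

setColSplit : List ℕ → List ℕ → ℕ → ℕ → ℕ → Filling → Filling
setColSplit la mu i c l T r c' =
  if (c' ≡ᵇ c) ∧ inShapeᵇ la mu r c' ∧ isIorI1 i (T r c')
  then (if r ≤ᵇ l then i else suc i)
  else T r c'

LowestI : List ℕ → List ℕ → ℕ → Filling → ℕ → ℕ → Set
LowestI la mu i T c l =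
  InShape la mu l c × T l c ≡ i × (∀ r → InShape la mu r c → T r c ≡ i → r ≤ l)

IsDescent : List ℕ → List ℕ → ℕ → Filling → ℕ → ℕ → Set
IsDescent la mu i T r A =
  InShape la mu r A × InShape la mu r (suc A) × T r A ≡ suc i × T r (suc A) ≡ i

NoDescent : List ℕ → List ℕ → ℕ → Filling → Set
NoDescent la mu i T = ∀ r A → ¬ IsDescent la mu i T r A

data Step (la mu : List ℕ) (i : ℕ) (T : Filling) : Filling → Set where
  mixed-ipure : ∀ r A l → IsDescent la mu i T r A →
    mixed la mu i T A ≡ true → iPure la mu i T (suc A) ≡ true → LowestI la mu i T A l →
    Step la mu i T (setColSplit la mu i (suc A) l (setColAll la mu i A i T))
  opure-mixed : ∀ r A l → IsDescent la mu i T r A →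
    opPure la mu i T A ≡ true → mixed la mu i T (suc A) ≡ true → LowestI la mu i T (suc A) l →
    Step la mu i T (setColAll la mu i (suc A) (suc i) (setColSplit la mu i A l T))
  opure-ipure : ∀ r A → IsDescent la mu i T r A →
    opPure la mu i T A ≡ true → iPure la mu i T (suc A) ≡ true →
    Step la mu i T (setColAll la mu i (suc A) (suc i) (setColAll la mu i A i T))

-- FRes la mu i T res : res is a possible value of f_i(T) (nothing = 0),
-- i.e. an outcome of the descent-resolution algorithm (any order of steps)
data FRes (la mu : List ℕ) (i : ℕ) (T : Filling) : Maybe Filling → Set where
  f-zero : rightmostUnmatchedCls (colWord la mu i T) ≡ nothing → FRes la mu i T nothing
  f-some : ∀ c T' → rightmostUnmatchedCls (colWord la mu i T) ≡ just c →
    Star (Step la mu i) (raise la mu i c T) T' → NoDescent la mu i T' →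
    FRes la mu i T (just T')

module Submission where

-- Both operators are bracket rules, and the rightmost unmatched closing
-- bracket of a word is characterised by inequalities between prefix counts
-- (Brackets).  Since the reading word skips every entry equal to the
-- one below it, a prefix of r T contains, for each value v, one letter v per
-- column whose v's reach into a "staircase" region: the rows below some row
-- r, together with row r left of some column q (PrefixCounts).  Comparing
-- the i and i+1 counts of such a region with a prefix of the column bracket
-- word (RegionBound) shows that F_i (r T) = 0 exactly when f_i T = 0, and
-- that otherwise the letter changed by F_i is the lowest i of the column c
-- selected by f_i, so F_i (r T) = r (raise c T) (RaisedCell, WordSide).
-- Finally, the descent-resolution algorithm started at raise c T is forced:
-- every step moves the unique descent one column to the right across a mixed
-- column without changing the reading word (ResolutionChain), and the descent
-- leaves the shape after finitely many steps (Resolution).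

open import Defs
open import Data.Nat using (ℕ; zero; suc; _+_; _∸_; _≤_; _<_; _≤ᵇ_; _<ᵇ_; _≡ᵇ_; z≤n; s≤s; s≤s⁻¹; _≤?_; _<?_)
open import Data.Nat.Properties
open import Data.Nat.Tactic.RingSolver using (solve-∀)
open import Data.Bool using (Bool; true; false; _∧_; _∨_; not; if_then_else_; T)
open import Data.Bool.ListAction using (any)
open import Data.List using (List; []; _∷_; length; _++_; take; drop; [_]; map; concatMap; upTo; applyUpTo; downFrom; last)
open import Data.List.Properties using (++-assoc; length-++; map-++; ++-identityʳ; length-map; take-map; drop-map; take++drop≡id; concatMap-++; drop-all; map-applyUpTo; take-[]; take-all)
open import Data.Maybe using (Maybe; just; nothing)
import Data.Maybe
open import Data.Product using (_×_; _,_; proj₁; proj₂; Σ; ∃)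
open import Data.Sum using (_⊎_; inj₁; inj₂)
open import Data.Empty using (⊥; ⊥-elim)
open import Data.Unit using (tt)
open import Function using (case_of_)
open import Relation.Nullary using (¬_; yes; no)
open import Relation.Binary.PropositionalEquality hiding ([_])
open import Relation.Binary.Construct.Closure.ReflexiveTransitive using (Star; ε; _◅_)
open import Relation.Binary.Definitions using (tri<; tri≈; tri>)

true≢false : ¬ (true ≡ false)
true≢false ()

i≢1+i : ∀ i → ¬ i ≡ suc i
i≢1+i i ()

≡ᵇ-true : ∀ {x y} → x ≡ y → (x ≡ᵇ y) ≡ true
≡ᵇ-true {x} {y} e with x ≡ᵇ y | ≡⇒≡ᵇ x y e
... | true | _ = refl

≡ᵇ-sound : ∀ {x y} → (x ≡ᵇ y) ≡ true → x ≡ y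
≡ᵇ-sound {x} {y} e = ≡ᵇ⇒≡ x y (subst T (sym e) tt)

≡ᵇ-false : ∀ {x y} → ¬ x ≡ y → (x ≡ᵇ y) ≡ false
≡ᵇ-false {x} {y} ne with x ≡ᵇ y in eq
... | true = ⊥-elim (ne (≡ᵇ-sound eq))
... | false = refl

≤ᵇ-true : ∀ {x y} → x ≤ y → (x ≤ᵇ y) ≡ true
≤ᵇ-true {x} {y} h with x ≤ᵇ y | ≤⇒≤ᵇ h
... | true | _ = refl

≤ᵇ-sound : ∀ {x y} → (x ≤ᵇ y) ≡ true → x ≤ y
≤ᵇ-sound {x} {y} e = ≤ᵇ⇒≤ x y (subst T (sym e) tt)

<ᵇ-true : ∀ {x y} → x < y → (x <ᵇ y) ≡ true
<ᵇ-true {x} {y} h with x <ᵇ y | <⇒<ᵇ h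
... | true | _ = refl

<ᵇ-sound : ∀ {x y} → (x <ᵇ y) ≡ true → x < y
<ᵇ-sound {x} {y} e = <ᵇ⇒< x y (subst T (sym e) tt)

<ᵇ-false : ∀ {x y} → y ≤ x → (x <ᵇ y) ≡ false
<ᵇ-false {x} {y} h with x <ᵇ y in eq
... | true = ⊥-elim (<-irrefl refl (<-≤-trans (<ᵇ-sound eq) h))
... | false = refl

∧-intro : ∀ {a b} → a ≡ true → b ≡ true → (a ∧ b) ≡ true
∧-intro refl refl = refl

∧-elimˡ : ∀ {a b} → (a ∧ b) ≡ true → a ≡ true
∧-elimˡ {true} e = refl

∧-elimʳ : ∀ {a b} → (a ∧ b) ≡ true → b ≡ true
∧-elimʳ {true} e = e

∧-falseʳ : ∀ {a b} → b ≡ false → (a ∧ b) ≡ false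
∧-falseʳ {true} refl = refl
∧-falseʳ {false} refl = refl

bool-ext : ∀ {a b : Bool} → (a ≡ true → b ≡ true) → (b ≡ true → a ≡ true) → a ≡ b
bool-ext {true} {true} f g = refl
bool-ext {true} {false} f g = sym (f refl)
bool-ext {false} {true} f g = g refl
bool-ext {false} {false} f g = refl

module _ {la mu : List ℕ} where
  inShapeᵇ-true : ∀ {r c} → InShape la mu r c → inShapeᵇ la mu r c ≡ true
  inShapeᵇ-true (h1 , h2) = ∧-intro (≤ᵇ-true h1) (<ᵇ-true h2)

  inShapeᵇ-sound : ∀ {r c} → inShapeᵇ la mu r c ≡ true → InShape la mu r c
  inShapeᵇ-sound e = ≤ᵇ-sound (∧-elimˡ e) , <ᵇ-sound (∧-elimʳ e)

  inShapeᵇ-false : ∀ {r c} → ¬ InShape la mu r c → inShapeᵇ la mu r c ≡ false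
  inShapeᵇ-false {r} {c} ne with inShapeᵇ la mu r c in eq
  ... | true = ⊥-elim (ne (inShapeᵇ-sound eq))
  ... | false = refl

  inShape? : ∀ r c → InShape la mu r c ⊎ ¬ InShape la mu r c
  inShape? r c with inShapeᵇ la mu r c in e
  ... | true = inj₁ (inShapeᵇ-sound e)
  ... | false = inj₂ (λ h → true≢false (trans (sym (inShapeᵇ-true h)) e))

cong₃ : ∀ {A B C D : Set} (f : A → B → C → D) {a a' b b' c c'} → a ≡ a' → b ≡ b' → c ≡ c' → f a b c ≡ f a' b' c'
cong₃ f refl refl refl = refl

between-i-1+i : ∀ {i} x → i ≤ x → x ≤ suc i → x ≡ i ⊎ x ≡ suc i
between-i-1+i {i} x h1 h2 with x ≟ i
... | yes e = inj₁ e
... | no ne = inj₂ (≤-antisym h2 (≤∧≢⇒< h1 (λ e → ne (sym e))))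

squeeze : ∀ {a b c v} → a ≤ b → b ≤ c → a ≡ v → c ≡ v → b ≡ v
squeeze h1 h2 refl refl = ≤-antisym h2 h1

-- Shapes: partitions are weakly decreasing, so rows and columns of a skew
-- shape are intervals and the shape is closed under the "corner" move.

partition-antitone : ∀ xs → Partition xs → ∀ {r r'} → r ≤ r' → at xs r' ≤ at xs r
partition-antitone xs p {r} {r'} h = subst (λ z → at xs z ≤ at xs r) (m∸n+n≡m h) (go (r' ∸ r) r)
  where
  go : ∀ k r → at xs (k + r) ≤ at xs r
  go zero r = ≤-refl
  go (suc k) r = ≤-trans (p (k + r)) (go k r)

at-beyond : ∀ xs r → length xs ≤ r → at xs r ≡ 0
at-beyond [] r h = refl
at-beyond (x ∷ xs) (suc r) (s≤s h) = at-beyond xs r h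

module Geometry {la mu : List ℕ} (sh : SkewShape la mu) where
  column-convex : ∀ {r r' x c} → InShape la mu r c → InShape la mu r' c → r ≤ x → x ≤ r' → InShape la mu x c
  column-convex (a1 , _) (_ , b2) h1 h2 =
    ≤-trans (partition-antitone mu (proj₁ (proj₂ sh)) h1) a1 , <-≤-trans b2 (partition-antitone la (proj₁ sh) h2)

  row-convex : ∀ {r c c' x} → InShape la mu r c → InShape la mu r c' → c ≤ x → x ≤ c' → InShape la mu r x
  row-convex (a1 , _) (_ , b2) h1 h2 = ≤-trans a1 h1 , ≤-<-trans h2 b2

  corner : ∀ {y c x d} → InShape la mu y c → InShape la mu x d → y ≤ x → c ≤ d → InShape la mu x c
  corner (a1 , _) (_ , b2) h1 h2 = ≤-trans (partition-antitone mu (proj₁ (proj₂ sh)) h1) a1 , ≤-<-trans h2 b2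

  row<length : ∀ {r c} → InShape la mu r c → r < length la
  row<length {r} {c} (_ , b) with length la ≤? r
  ... | yes h = ⊥-elim (n≮0 (subst (c <_) (at-beyond la r h) b))
  ... | no h = ≰⇒> h

  col<width : ∀ {r c} → InShape la mu r c → c < at la 0
  col<width (_ , b) = <-≤-trans b (partition-antitone la (proj₁ sh) z≤n)

module Monotone {la mu : List ℕ} (sh : SkewShape la mu) {m : ℕ} {T : Filling} (rpp : RPP la mu m T) where
  open Geometry {la} {mu} sh

  row-mono : ∀ {r c c'} → InShape la mu r c → InShape la mu r c' → c ≤ c' → T r c ≤ T r c'
  row-mono {r} {c} {c'} h1 h2 le =
    subst (λ z → T r c ≤ T r z) (m∸n+n≡m le) (go (c' ∸ c) (subst (InShape la mu r) (sym (m∸n+n≡m le)) h2))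
    where
    go : ∀ k → InShape la mu r (k + c) → T r c ≤ T r (k + c)
    go zero _ = ≤-refl
    go (suc k) h = let hk = row-convex h1 h (m≤n+m c k) (n≤1+n (k + c)) in
      ≤-trans (go k hk) (proj₁ (proj₂ rpp) r (k + c) hk h)

  col-mono : ∀ {r r' c} → InShape la mu r c → InShape la mu r' c → r ≤ r' → T r c ≤ T r' c
  col-mono {r} {r'} {c} h1 h2 le =
    subst (λ z → T r c ≤ T z c) (m∸n+n≡m le) (go (r' ∸ r) (subst (λ z → InShape la mu z c) (sym (m∸n+n≡m le)) h2))
    where
    go : ∀ k → InShape la mu (k + r) c → T r c ≤ T (k + r) c
    go zero _ = ≤-refl
    go (suc k) h = let hk = column-convex h1 h (m≤n+m r k) (n≤1+n (k + r)) in
      ≤-trans (go k hk) (proj₂ (proj₂ rpp) (k + r) c hk h)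

-- Brackets.  Counting opening and closing brackets, and the position of the
-- rightmost unmatched closing bracket in terms of prefix counts.

#opn #cls : List Paren → ℕ
#opn [] = 0
#opn (opn ∷ xs) = suc (#opn xs)
#opn (cls ∷ xs) = #opn xs
#opn (non ∷ xs) = #opn xs
#cls [] = 0
#cls (opn ∷ xs) = #cls xs
#cls (cls ∷ xs) = suc (#cls xs)
#cls (non ∷ xs) = #cls xs

#opn-++ : ∀ xs ys → #opn (xs ++ ys) ≡ #opn xs + #opn ys
#opn-++ [] ys = refl
#opn-++ (opn ∷ xs) ys = cong suc (#opn-++ xs ys)
#opn-++ (cls ∷ xs) ys = #opn-++ xs ys
#opn-++ (non ∷ xs) ys = #opn-++ xs ys

#cls-++ : ∀ xs ys → #cls (xs ++ ys) ≡ #cls xs + #cls ys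
#cls-++ [] ys = refl
#cls-++ (opn ∷ xs) ys = #cls-++ xs ys
#cls-++ (cls ∷ xs) ys = cong suc (#cls-++ xs ys)
#cls-++ (non ∷ xs) ys = #cls-++ xs ys

#opn-take-drop : ∀ n xs → #opn (take n xs) + #opn (drop n xs) ≡ #opn xs
#opn-take-drop n xs = trans (sym (#opn-++ (take n xs) (drop n xs))) (cong #opn (take++drop≡id n xs))

#cls-take-drop : ∀ n xs → #cls (take n xs) + #cls (drop n xs) ≡ #cls xs
#cls-take-drop n xs = trans (sym (#cls-++ (take n xs) (drop n xs))) (cong #cls (take++drop≡id n xs))

take-++-≤ : ∀ {A : Set} n (U W : List A) → n ≤ length U → take n (U ++ W) ≡ take n U
take-++-≤ zero U W h = refl
take-++-≤ (suc n) (x ∷ U) W (s≤s h) = cong (x ∷_) (take-++-≤ n U W h)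

take-++-+ : ∀ {A : Set} m (U W : List A) → take (length U + m) (U ++ W) ≡ U ++ take m W
take-++-+ m [] W = refl
take-++-+ m (x ∷ U) W = cong (x ∷_) (take-++-+ m U W)

last-snoc : ∀ {A : Set} (L : List A) x → last (L ++ [ x ]) ≡ just x
last-snoc [] x = refl
last-snoc (y ∷ []) x = refl
last-snoc (y ∷ z ∷ L) x = last-snoc (z ∷ L) x

last-nothing : ∀ {A : Set} (xs : List A) → last xs ≡ nothing → xs ≡ []
last-nothing [] e = refl
last-nothing (x ∷ y ∷ xs) e with last-nothing (y ∷ xs) e
... | ()

-- Number of opening brackets still unmatched after scanning a word, starting
-- with k unmatched ones; this is the state unmatchedCls carries along.
pendingOpen : ℕ → List Paren → ℕ
pendingOpen k [] = k
pendingOpen k (opn ∷ xs) = pendingOpen (suc k) xs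
pendingOpen zero (cls ∷ xs) = pendingOpen zero xs
pendingOpen (suc k) (cls ∷ xs) = pendingOpen k xs
pendingOpen k (non ∷ xs) = pendingOpen k xs

unmatchedCls-++ : ∀ k p U ys →
  unmatchedCls k p (U ++ ys) ≡ unmatchedCls k p U ++ unmatchedCls (pendingOpen k U) (p + length U) ys
unmatchedCls-++ k p [] ys = cong (λ z → unmatchedCls k z ys) (sym (+-identityʳ p))
unmatchedCls-++ k p (opn ∷ U) ys = trans (unmatchedCls-++ (suc k) (suc p) U ys) (cong (λ z → unmatchedCls (suc k) (suc p) U ++ unmatchedCls (pendingOpen (suc k) U) z ys) (sym (+-suc p _)))
unmatchedCls-++ zero p (cls ∷ U) ys = cong (p ∷_) (trans (unmatchedCls-++ zero (suc p) U ys) (cong (λ z → unmatchedCls zero (suc p) U ++ unmatchedCls (pendingOpen zero U) z ys) (sym (+-suc p _))))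
unmatchedCls-++ (suc k) p (cls ∷ U) ys = trans (unmatchedCls-++ k (suc p) U ys) (cong (λ z → unmatchedCls k (suc p) U ++ unmatchedCls (pendingOpen k U) z ys) (sym (+-suc p _)))
unmatchedCls-++ k p (non ∷ U) ys = trans (unmatchedCls-++ k (suc p) U ys) (cong (λ z → unmatchedCls k (suc p) U ++ unmatchedCls (pendingOpen k U) z ys) (sym (+-suc p _)))

noUnmatched-from-prefixes : ∀ k p xs → (∀ n → #cls (take n xs) ≤ k + #opn (take n xs)) → unmatchedCls k p xs ≡ []
noUnmatched-from-prefixes k p [] h = refl
noUnmatched-from-prefixes k p (opn ∷ xs) h = noUnmatched-from-prefixes (suc k) (suc p) xs (λ n → subst (#cls (take n xs) ≤_) (+-suc k _) (h (suc n)))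
noUnmatched-from-prefixes zero p (cls ∷ xs) h with h 1
... | ()
noUnmatched-from-prefixes (suc k) p (cls ∷ xs) h = noUnmatched-from-prefixes k (suc p) xs (λ n → s≤s⁻¹ (h (suc n)))
noUnmatched-from-prefixes k p (non ∷ xs) h = noUnmatched-from-prefixes k (suc p) xs (λ n → h (suc n))

prefixes-from-noUnmatched : ∀ k p xs → unmatchedCls k p xs ≡ [] → ∀ n → #cls (take n xs) ≤ k + #opn (take n xs)
prefixes-from-noUnmatched k p xs e zero = z≤n
prefixes-from-noUnmatched k p [] e (suc n) = z≤n
prefixes-from-noUnmatched k p (opn ∷ xs) e (suc n) = subst (#cls (take n xs) ≤_) (sym (+-suc k _)) (prefixes-from-noUnmatched (suc k) (suc p) xs e n)
prefixes-from-noUnmatched (suc k) p (cls ∷ xs) e (suc n) = s≤s (prefixes-from-noUnmatched k (suc p) xs e n)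
prefixes-from-noUnmatched k p (non ∷ xs) e (suc n) = prefixes-from-noUnmatched k (suc p) xs e n

SuffixesClosed : List Paren → Set
SuffixesClosed U = ∀ n → #opn (drop n U) ≤ #cls (drop n U)

pendingOpen-zero : ∀ k U → k + #opn U ≤ #cls U → SuffixesClosed U → pendingOpen k U ≡ 0
pendingOpen-zero zero [] h d = refl
pendingOpen-zero k (opn ∷ U) h d = pendingOpen-zero (suc k) U (subst (_≤ #cls U) (+-suc k _) h) (λ n → d (suc n))
pendingOpen-zero zero (cls ∷ U) h d = pendingOpen-zero zero U (d 1) (λ n → d (suc n))
pendingOpen-zero (suc k) (cls ∷ U) h d = pendingOpen-zero k U (s≤s⁻¹ h) (λ n → d (suc n))
pendingOpen-zero k (non ∷ U) h d = pendingOpen-zero k U h (λ n → d (suc n))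

pendingOpen-zero⁻¹ : ∀ k U → pendingOpen k U ≡ 0 → (k + #opn U ≤ #cls U) × SuffixesClosed U
pendingOpen-zero⁻¹ k [] e = subst (λ z → z + 0 ≤ 0) (sym e) z≤n , λ { zero → z≤n ; (suc n) → z≤n }
pendingOpen-zero⁻¹ k (opn ∷ U) e with pendingOpen-zero⁻¹ (suc k) U e
... | h , d = subst (_≤ #cls U) (sym (+-suc k _)) h , λ { zero → ≤-trans (s≤s (m≤n+m (#opn U) k)) h ; (suc n) → d n }
pendingOpen-zero⁻¹ zero (cls ∷ U) e with pendingOpen-zero⁻¹ zero U e
... | h , d = m≤n⇒m≤1+n h , λ { zero → m≤n⇒m≤1+n h ; (suc n) → d n }
pendingOpen-zero⁻¹ (suc k) (cls ∷ U) e with pendingOpen-zero⁻¹ k U e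
... | h , d = s≤s h , λ { zero → m≤n⇒m≤1+n (≤-trans (m≤n+m (#opn U) k) h) ; (suc n) → d n }
pendingOpen-zero⁻¹ k (non ∷ U) e with pendingOpen-zero⁻¹ k U e
... | h , d = h , λ { zero → ≤-trans (m≤n+m (#opn U) k) h ; (suc n) → d n }

-- The rightmost unmatched closing bracket splits the word as U ++ cls ∷ V,
-- where U leaves nothing pending and V has no unmatched closing bracket;
-- conversely such a split locates the rightmost unmatched one.
RightmostSplit : List Paren → List Paren → Set
RightmostSplit U V = (pendingOpen 0 U ≡ 0) × (unmatchedCls 0 (suc (length U)) V ≡ [])

rightmost-split : ∀ k p ys c → last (unmatchedCls k p ys) ≡ just c →
  Σ (List Paren) λ U → Σ (List Paren) λ V → (ys ≡ U ++ cls ∷ V) × (c ≡ p + length U) × (pendingOpen k U ≡ 0) × (unmatchedCls 0 (suc c) V ≡ [])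
rightmost-split k p [] c ()
rightmost-split k p (opn ∷ ys) c e with rightmost-split (suc k) (suc p) ys c e
... | U , V , e1 , e2 , e3 , e4 = opn ∷ U , V , cong (opn ∷_) e1 , trans e2 (sym (+-suc p _)) , e3 , e4
rightmost-split zero p (cls ∷ ys) c e with unmatchedCls zero (suc p) ys in eq
... | [] = [] , ys , refl , trans (sym (just-injective e)) (sym (+-identityʳ p)) , refl , subst (λ z → unmatchedCls 0 (suc z) ys ≡ []) (just-injective e) eq
  where just-injective : ∀ {a b : ℕ} → just a ≡ just b → a ≡ b
        just-injective refl = refl
... | x ∷ L with rightmost-split zero (suc p) ys c (trans (cong last eq) e)
... | U , V , e1 , e2 , e3 , e4 = cls ∷ U , V , cong (cls ∷_) e1 , trans e2 (sym (+-suc p _)) , e3 , e4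
rightmost-split (suc k) p (cls ∷ ys) c e with rightmost-split k (suc p) ys c e
... | U , V , e1 , e2 , e3 , e4 = cls ∷ U , V , cong (cls ∷_) e1 , trans e2 (sym (+-suc p _)) , e3 , e4
rightmost-split k p (non ∷ ys) c e with rightmost-split k (suc p) ys c e
... | U , V , e1 , e2 , e3 , e4 = non ∷ U , V , cong (non ∷_) e1 , trans e2 (sym (+-suc p _)) , e3 , e4

rightmost-at-split : ∀ U V → RightmostSplit U V → last (unmatchedCls 0 0 (U ++ cls ∷ V)) ≡ just (length U)
rightmost-at-split U V (e1 , e2) rewrite unmatchedCls-++ 0 0 U (cls ∷ V) | e1 | e2 = last-snoc (unmatchedCls 0 0 U) (length U)

-- The split condition only depends on prefix counts of U ++ cls ∷ V: before
-- the marked bracket no prefix has more closing-minus-opening brackets than U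
-- (BeforeCond), and no prefix at all exceeds that excess by more than one
-- (AfterCond).  Hence two words with the same prefix statistics share the
-- position of the rightmost unmatched closing bracket.
module SplitConditions (U V : List Paren) where
  xs = U ++ cls ∷ V

  BeforeCond AfterCond : Set
  BeforeCond = ∀ n → n ≤ length U → #cls (take n xs) + #opn U ≤ #opn (take n xs) + #cls U
  AfterCond = ∀ n → #cls (take n xs) + #opn U ≤ #opn (take n xs) + suc (#cls U)

  private
    shift : ∀ a b x y → x ≤ y → a + (b + x) ≤ b + (a + y)
    shift a b x y h = subst₂ _≤_ (e1 a b x) (e2 a b y) (+-monoʳ-≤ (a + b) h)
      where e1 : ∀ a b x → (a + b) + x ≡ a + (b + x)
            e1 = solve-∀
            e2 : ∀ a b y → (a + b) + y ≡ b + (a + y)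
            e2 = solve-∀

    unshift : ∀ a b x y → a + (b + x) ≤ b + (a + y) → x ≤ y
    unshift a b x y h = +-cancelˡ-≤ (a + b) x y (subst₂ _≤_ (sym (e1 a b x)) (sym (e2 a b y)) h)
      where e1 : ∀ a b x → (a + b) + x ≡ a + (b + x)
            e1 = solve-∀
            e2 : ∀ a b y → (a + b) + y ≡ b + (a + y)
            e2 = solve-∀

    shift₁ : ∀ a b x y → x ≤ y → (a + suc x) + b ≤ (b + y) + suc a
    shift₁ a b x y h = subst₂ _≤_ (e1 a b x) (e2 a b y) (+-monoʳ-≤ (suc (a + b)) h)
      where e1 : ∀ a b x → suc (a + b) + x ≡ (a + suc x) + b
            e1 = solve-∀
            e2 : ∀ a b y → suc (a + b) + y ≡ (b + y) + suc a
            e2 = solve-∀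

    unshift₁ : ∀ a b x y → (a + suc x) + b ≤ (b + y) + suc a → x ≤ y
    unshift₁ a b x y h = +-cancelˡ-≤ (suc (a + b)) x y (subst₂ _≤_ (sym (e1 a b x)) (sym (e2 a b y)) h)
      where e1 : ∀ a b x → suc (a + b) + x ≡ (a + suc x) + b
            e1 = solve-∀
            e2 : ∀ a b y → suc (a + b) + y ≡ (b + y) + suc a
            e2 = solve-∀

    before⇒suffix : ∀ n → n ≤ length U → #opn (drop n U) ≤ #cls (drop n U) → #cls (take n xs) + #opn U ≤ #opn (take n xs) + #cls U
    before⇒suffix n le d rewrite take-++-≤ n U (cls ∷ V) le
      | sym (#opn-take-drop n U) | sym (#cls-take-drop n U) = shift (#cls (take n U)) (#opn (take n U)) _ _ d

    suffix⇒before : ∀ n → n ≤ length U → #cls (take n xs) + #opn U ≤ #opn (take n xs) + #cls U → #opn (drop n U) ≤ #cls (drop n U)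
    suffix⇒before n le h rewrite take-++-≤ n U (cls ∷ V) le
      | sym (#opn-take-drop n U) | sym (#cls-take-drop n U) = unshift (#cls (take n U)) (#opn (take n U)) _ _ h

    after⇒tail : ∀ m → #cls (take m V) ≤ #opn (take m V) → #cls (take (length U + suc m) xs) + #opn U ≤ #opn (take (length U + suc m) xs) + suc (#cls U)
    after⇒tail m h rewrite take-++-+ (suc m) U (cls ∷ V) | #opn-++ U (cls ∷ take m V) | #cls-++ U (cls ∷ take m V) =
      shift₁ (#cls U) (#opn U) _ _ h

    tail⇒after : ∀ m → #cls (take (length U + suc m) xs) + #opn U ≤ #opn (take (length U + suc m) xs) + suc (#cls U) → #cls (take m V) ≤ #opn (take m V)
    tail⇒after m h rewrite take-++-+ (suc m) U (cls ∷ V) | #opn-++ U (cls ∷ take m V) | #cls-++ U (cls ∷ take m V) =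
      unshift₁ (#cls U) (#opn U) _ _ h

    beyond : ∀ n L → ¬ n ≤ L → Σ ℕ λ m → n ≡ L + suc m
    beyond n L h = n ∸ suc L , trans (sym (m+[n∸m]≡n {suc L} {n} (≰⇒> h))) (sym (+-suc L (n ∸ suc L)))

  split⇒conds : RightmostSplit U V → BeforeCond × AfterCond
  split⇒conds (e1 , e2) = before , after
    where
    before : BeforeCond
    before n le = before⇒suffix n le (proj₂ (pendingOpen-zero⁻¹ 0 U e1) n)
    after : AfterCond
    after n with n ≤? length U
    ... | yes le = ≤-trans (before n le) (+-monoʳ-≤ (#opn (take n xs)) (n≤1+n (#cls U)))
    ... | no gt with beyond n (length U) gt
    ... | m , refl = after⇒tail m (prefixes-from-noUnmatched 0 _ V e2 m)

  conds⇒split : BeforeCond → AfterCond → RightmostSplit U V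
  conds⇒split before after =
    pendingOpen-zero 0 U (suffix⇒before 0 z≤n (before 0 z≤n)) suffixes ,
    noUnmatched-from-prefixes 0 _ V (λ m → tail⇒after m (after (length U + suc m)))
    where
    suffixes : SuffixesClosed U
    suffixes n with n ≤? length U
    ... | yes le = suffix⇒before n le (before n le)
    ... | no gt rewrite drop-all n U (≰⇒≥ gt) = z≤n

range : ℕ → ℕ → List ℕ
range a zero = []
range a (suc n) = a ∷ range (suc a) n

head∈range : ∀ a n → a < a + suc n
head∈range a n = subst (a <_) (sym (+-suc a n)) (s≤s (m≤m+n a n))

tail∈range : ∀ {a n x} → x < suc a + n → x < a + suc n
tail∈range {a} {n} {x} h = subst (x <_) (sym (+-suc a n)) h

applyUpTo-range : ∀ (f : ℕ → ℕ) a n → (∀ x → f x ≡ a + x) → applyUpTo f n ≡ range a n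
applyUpTo-range f a zero h = refl
applyUpTo-range f a (suc n) h = cong₂ _∷_ (trans (h 0) (+-identityʳ a)) (applyUpTo-range (λ x → f (suc x)) (suc a) n (λ x → trans (h (suc x)) (+-suc a x)))

shifted-upTo : ∀ a n → map (a +_) (upTo n) ≡ range a n
shifted-upTo a n = trans (map-applyUpTo (λ x → x) (a +_) n) (applyUpTo-range (a +_) a n (λ x → refl))

upTo-range : ∀ n → upTo n ≡ range 0 n
upTo-range n = applyUpTo-range (λ x → x) 0 n (λ x → refl)

range-++ : ∀ a j k → range a (j + k) ≡ range a j ++ range (a + j) k
range-++ a zero k = cong (λ z → range z k) (sym (+-identityʳ a))
range-++ a (suc j) k = cong (a ∷_) (trans (range-++ (suc a) j k) (cong (λ z → range (suc a) j ++ range z k) (sym (+-suc a j))))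

range-mid : ∀ a j n → j < n → range a n ≡ range a j ++ (a + j) ∷ range (suc (a + j)) (n ∸ suc j)
range-mid a j n h = trans (cong (range a) (sym (m+[n∸m]≡n (<⇒≤ h)))) (trans (range-++ a j (n ∸ j))
  (cong (range a j ++_) (cong (range (a + j)) (+-∸-assoc 1 {n} {suc j} h))))

take-range : ∀ a j n → j ≤ n → take j (range a n) ≡ range a j
take-range a zero n h = refl
take-range a (suc j) (suc n) (s≤s h) = cong (a ∷_) (take-range (suc a) j n h)

drop-range : ∀ a j n → drop j (range a n) ≡ range (a + j) (n ∸ j)
drop-range a zero n = cong (λ z → range z n) (sym (+-identityʳ a))
drop-range a (suc j) zero = refl
drop-range a (suc j) (suc n) = trans (drop-range (suc a) j n) (cong (λ z → range z (n ∸ j)) (sym (+-suc a j)))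

length-range : ∀ a n → length (range a n) ≡ n
length-range a zero = refl
length-range a (suc n) = cong suc (length-range (suc a) n)

any-range-sound : ∀ (p : ℕ → Bool) a n → any p (range a n) ≡ true → Σ ℕ λ x → a ≤ x × x < a + n × p x ≡ true
any-range-sound p a (suc n) e with p a in eq
... | true = a , ≤-refl , head∈range a n , eq
... | false with any-range-sound p (suc a) n e
... | x , h1 , h2 , h3 = x , <⇒≤ h1 , tail∈range h2 , h3

any-range-true : ∀ (p : ℕ → Bool) a n x → a ≤ x → x < a + n → p x ≡ true → any p (range a n) ≡ true
any-range-true p a zero x h1 h2 h3 = ⊥-elim (<-irrefl refl (≤-<-trans h1 (subst (x <_) (+-identityʳ a) h2)))
any-range-true p a (suc n) x h1 h2 h3 with p a in eq
... | true = refl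
... | false with a ≟ x
... | yes refl = ⊥-elim (true≢false (trans (sym h3) eq))
... | no ne = any-range-true p (suc a) n x (≤∧≢⇒< h1 ne) (subst (x <_) (+-suc a n) h2) h3

-- The largest x < n satisfying p (0 when there is none).
maxBelow : (ℕ → Bool) → ℕ → ℕ
maxBelow p zero = 0
maxBelow p (suc n) = if p n then n else maxBelow p n

maxBelow-spec : ∀ p n → (Σ ℕ λ x → x < n × p x ≡ true) → p (maxBelow p n) ≡ true × (∀ x → x < n → p x ≡ true → x ≤ maxBelow p n)
maxBelow-spec p (suc n) w with p n in eq
... | true = eq , λ x h _ → s≤s⁻¹ h
... | false with w
... | x , h1 , h2 with x ≟ n
... | yes refl = ⊥-elim (true≢false (trans (sym h2) eq))
... | no ne with maxBelow-spec p n (x , ≤∧≢⇒< (s≤s⁻¹ h1) ne , h2)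
... | a , b = a , λ y hy py → case y ≟ n of λ where
        (yes refl) → ⊥-elim (true≢false (trans (sym py) eq))
        (no ne') → b y (≤∧≢⇒< (s≤s⁻¹ hy) ne') py

-- The least δ such that p fails on [δ , n): everything before δ is
-- dominated by some later point satisfying p.
lastTrue : (ℕ → Bool) → ℕ → ℕ
lastTrue p zero = 0
lastTrue p (suc n) = if p n then suc n else lastTrue p n

lastTrue-≤ : ∀ p n → lastTrue p n ≤ n
lastTrue-≤ p zero = z≤n
lastTrue-≤ p (suc n) with p n
... | true = ≤-refl
... | false = m≤n⇒m≤1+n (lastTrue-≤ p n)

lastTrue-after : ∀ p n d → lastTrue p n ≤ d → d < n → p d ≡ false
lastTrue-after p (suc n) d h1 h2 with p n in eq
... | true = ⊥-elim (<-irrefl refl (<-≤-trans h2 h1))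
... | false with d ≟ n
... | yes refl = eq
... | no ne = lastTrue-after p n d h1 (≤∧≢⇒< (s≤s⁻¹ h2) ne)

lastTrue-before : ∀ p n d → d < lastTrue p n → Σ ℕ λ e → d ≤ e × e < n × p e ≡ true
lastTrue-before p (suc n) d h with p n in eq
... | true = n , s≤s⁻¹ h , ≤-refl , eq
... | false with lastTrue-before p n d h
... | e , h1 , h2 , h3 = e , h1 , m<n⇒m<1+n h2 , h3

sumRange : (ℕ → ℕ) → ℕ → ℕ → ℕ
sumRange f a zero = 0
sumRange f a (suc n) = f a + sumRange f (suc a) n

sumRange-cong : ∀ f g a n → (∀ x → a ≤ x → x < a + n → f x ≡ g x) → sumRange f a n ≡ sumRange g a n
sumRange-cong f g a zero h = refl
sumRange-cong f g a (suc n) h = cong₂ _+_ (h a ≤-refl (head∈range a n))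
  (sumRange-cong f g (suc a) n (λ x h1 h2 → h x (<⇒≤ h1) (tail∈range h2)))

sumRange-mono : ∀ f g a n → (∀ x → a ≤ x → x < a + n → f x ≤ g x) → sumRange f a n ≤ sumRange g a n
sumRange-mono f g a zero h = z≤n
sumRange-mono f g a (suc n) h = +-mono-≤ (h a ≤-refl (head∈range a n))
  (sumRange-mono f g (suc a) n (λ x h1 h2 → h x (<⇒≤ h1) (tail∈range h2)))

sumRange-zero : ∀ f a n → (∀ x → a ≤ x → x < a + n → f x ≡ 0) → sumRange f a n ≡ 0
sumRange-zero f a zero h = refl
sumRange-zero f a (suc n) h = cong₂ _+_ (h a ≤-refl (head∈range a n))
  (sumRange-zero f (suc a) n (λ x h1 h2 → h x (<⇒≤ h1) (tail∈range h2)))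

sumRange-+ : ∀ f g a n → sumRange (λ x → f x + g x) a n ≡ sumRange f a n + sumRange g a n
sumRange-+ f g a zero = refl
sumRange-+ f g a (suc n) rewrite sumRange-+ f g (suc a) n = e (f a) (g a) (sumRange f (suc a) n) (sumRange g (suc a) n)
  where e : ∀ p q r s → (p + q) + (r + s) ≡ (p + r) + (q + s)
        e = solve-∀

sumRange-split : ∀ f a j k → sumRange f a (j + k) ≡ sumRange f a j + sumRange f (a + j) k
sumRange-split f a zero k = cong (λ z → sumRange f z k) (sym (+-identityʳ a))
sumRange-split f a (suc j) k = trans (cong (f a +_) (trans (sumRange-split f (suc a) j k) (cong (λ z → sumRange f (suc a) j + sumRange f z k) (sym (+-suc a j))))) (sym (+-assoc (f a) _ _))

sumRange-point : ∀ f g a n q → a ≤ q → q < a + n → (∀ x → ¬ x ≡ q → f x ≡ g x) → sumRange f a n + g q ≡ sumRange g a n + f q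
sumRange-point f g a zero q h1 h2 h = ⊥-elim (<-irrefl refl (≤-<-trans h1 (subst (q <_) (+-identityʳ a) h2)))
sumRange-point f g a (suc n) q h1 h2 h with a ≟ q
... | yes refl rewrite sumRange-cong f g (suc a) n (λ x h3 _ → h x (λ e → <-irrefl (sym e) h3)) = e (f a) (g a) (sumRange g (suc a) n)
  where e : ∀ p q r → (p + r) + q ≡ (q + r) + p
        e = solve-∀
... | no ne rewrite h a ne = trans (+-assoc (g a) _ _) (trans (cong (g a +_) (sumRange-point f g (suc a) n q (≤∧≢⇒< h1 ne) (subst (q <_) (+-suc a n) h2) h)) (sym (+-assoc (g a) _ _)))

below : ℕ → ℕ → ℕ → ℕ
below δ d x = if d <ᵇ δ then x else 0

below-lt : ∀ {δ d} x → d < δ → below δ d x ≡ x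
below-lt x h rewrite <ᵇ-true h = refl

below-ge : ∀ {δ d} x → δ ≤ d → below δ d x ≡ 0
below-ge {δ} {d} x h rewrite <ᵇ-false {d} {δ} h = refl

sumRange-below : ∀ f δ W → δ ≤ W → sumRange (λ d → below δ d (f d)) 0 W ≡ sumRange f 0 δ
sumRange-below f δ W h = begin
  sumRange (λ d → below δ d (f d)) 0 W
    ≡⟨ cong (sumRange _ 0) (sym (m+[n∸m]≡n h)) ⟩
  sumRange (λ d → below δ d (f d)) 0 (δ + (W ∸ δ))
    ≡⟨ sumRange-split _ 0 δ (W ∸ δ) ⟩
  sumRange (λ d → below δ d (f d)) 0 δ + sumRange (λ d → below δ d (f d)) δ (W ∸ δ)
    ≡⟨ cong₂ _+_ (sumRange-cong _ f 0 δ (λ x _ h2 → below-lt (f x) h2)) (sumRange-zero _ δ (W ∸ δ) (λ x h1 _ → below-ge (f x) h1)) ⟩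
  sumRange f 0 δ + 0
    ≡⟨ +-identityʳ _ ⟩
  sumRange f 0 δ ∎
  where open ≡-Reasoning

concatMap-cong-range : ∀ {B : Set} (f g : ℕ → List B) a n → (∀ x → a ≤ x → x < a + n → f x ≡ g x) → concatMap f (range a n) ≡ concatMap g (range a n)
concatMap-cong-range f g a zero h = refl
concatMap-cong-range f g a (suc n) h = cong₂ _++_ (h a ≤-refl (head∈range a n))
  (concatMap-cong-range f g (suc a) n (λ x h1 h2 → h x (<⇒≤ h1) (tail∈range h2)))

take-concatMap : ∀ {A B : Set} (f : A → List B) → (∀ x → length (f x) ≤ 1) → ∀ n xs →
  Σ ℕ λ j → j ≤ length xs × take n (concatMap f xs) ≡ concatMap f (take j xs)
take-concatMap f h zero xs = 0 , z≤n , refl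
take-concatMap f h (suc n) [] = 0 , z≤n , refl
take-concatMap f h (suc n) (x ∷ xs) with f x in eq | h x
... | [] | _ with take-concatMap f h (suc n) xs
... | j , hj , e = suc j , s≤s hj , trans e (cong (_++ concatMap f (take j xs)) (sym eq))
take-concatMap f h (suc n) (x ∷ xs) | y ∷ [] | _ with take-concatMap f h n xs
... | j , hj , e = suc j , s≤s hj , trans (cong (y ∷_) e) (cong (_++ concatMap f (take j xs)) (sym eq))
take-concatMap f h (suc n) (x ∷ xs) | y ∷ z ∷ w | s≤s ()

regroup : ∀ {B : Set} (A P : List B) x (Q Z : List B) → A ++ ((P ++ (x ∷ [] ++ Q)) ++ Z) ≡ (A ++ P) ++ x ∷ (Q ++ Z)
regroup A P x Q Z = trans (cong (A ++_) (++-assoc P (x ∷ Q) Z)) (sym (++-assoc A P (x ∷ Q ++ Z)))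

concatMap-swap : ∀ {B : Set} (f g : ℕ → List B) a n A → a ≤ A → suc A < a + n →
  (∀ x → a ≤ x → x < a + n → ¬ x ≡ A → ¬ x ≡ suc A → f x ≡ g x) → f A ++ f (suc A) ≡ g A ++ g (suc A) →
  concatMap f (range a n) ≡ concatMap g (range a n)
concatMap-swap f g a n A h1 h2 h e = begin
  concatMap f (range a n)
    ≡⟨ cong (concatMap f) split ⟩
  concatMap f (range a j ++ A ∷ suc A ∷ rest)
    ≡⟨ concatMap-++ f (range a j) _ ⟩
  concatMap f (range a j) ++ (f A ++ (f (suc A) ++ concatMap f rest))
    ≡⟨ cong₂ _++_ (concatMap-cong-range f g a j (λ x x1 x2 → h x x1 (before x2) (λ e → <-irrefl e (toA x2)) (λ e → <-irrefl e (<-trans (toA x2) (n<1+n A))))) (block (concatMap-cong-range f g (suc (suc A)) k after)) ⟩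
  concatMap g (range a j) ++ (g A ++ (g (suc A) ++ concatMap g rest))
    ≡⟨ sym (concatMap-++ g (range a j) _) ⟩
  concatMap g (range a j ++ A ∷ suc A ∷ rest)
    ≡⟨ cong (concatMap g) (sym split) ⟩
  concatMap g (range a n) ∎
  where
  open ≡-Reasoning
  j = A ∸ a
  k = n ∸ suc (suc j)
  rest = range (suc (suc A)) k
  aj : a + j ≡ A
  aj = m+[n∸m]≡n h1
  jn : suc (suc j) ≤ n
  jn = +-cancelˡ-≤ a (suc (suc j)) n (subst (_≤ a + n) (trans (cong (λ z → suc (suc z)) (sym aj)) (sym (trans (+-suc a (suc j)) (cong suc (+-suc a j))))) h2)
  split : range a n ≡ range a j ++ A ∷ suc A ∷ rest
  split = trans (cong (range a) (sym (trans (+-suc j (suc k)) (trans (cong suc (+-suc j k)) (m+[n∸m]≡n jn))))) (trans (range-++ a j (suc (suc k)))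
    (cong (λ z → range a j ++ z ∷ suc z ∷ range (suc (suc z)) k) aj))
  end : suc (suc A) + k ≡ a + n
  end = trans (cong (λ z → suc (suc z) + k) (sym aj)) (trans (cong (_+ k) (sym (trans (+-suc a (suc j)) (cong suc (+-suc a j)))))
    (trans (+-assoc a (suc (suc j)) k) (cong (a +_) (m+[n∸m]≡n jn))))
  before : ∀ {x} → x < a + j → x < a + n
  before x2 = <-≤-trans x2 (+-monoʳ-≤ a (≤-trans (n≤1+n j) (≤-trans (n≤1+n (suc j)) jn)))
  toA : ∀ {x} → x < a + j → x < A
  toA {x} = subst (x <_) aj
  after : ∀ x → suc (suc A) ≤ x → x < suc (suc A) + k → f x ≡ g x
  after x x1 x2 = h x (≤-trans h1 (≤-trans (n≤1+n A) (<⇒≤ x1))) (subst (x <_) end x2)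
    (λ e → <-irrefl (sym e) (<-trans (n<1+n A) x1)) (λ e → <-irrefl (sym e) x1)
  block : concatMap f rest ≡ concatMap g rest → f A ++ (f (suc A) ++ concatMap f rest) ≡ g A ++ (g (suc A) ++ concatMap g rest)
  block r = trans (sym (++-assoc (f A) (f (suc A)) _)) (trans (cong₂ _++_ e r) (++-assoc (g A) (g (suc A)) _))

+-exchange : ∀ a b c → (a + b) + c ≡ (a + c) + b
+-exchange = solve-∀

+-rotate : ∀ a b c → (a + b) + c ≡ b + (a + c)
+-rotate = solve-∀

module ReadingWord (la mu : List ℕ) where
  L = length la
  W = at la 0

  cellLetters : Filling → ℕ → ℕ → List ℕ
  cellLetters X r c = if inShapeᵇ la mu (suc r) c ∧ (X (suc r) c ≡ᵇ X r c) then [] else (X r c ∷ [])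

  cellLetters-length : ∀ X r d → length (cellLetters X r d) ≤ 1
  cellLetters-length X r d with inShapeᵇ la mu (suc r) d ∧ (X (suc r) d ≡ᵇ X r d)
  ... | true = z≤n
  ... | false = s≤s z≤n

  cellLetters-kept : ∀ X r d → (InShape la mu (suc r) d → ¬ X (suc r) d ≡ X r d) → cellLetters X r d ≡ X r d ∷ []
  cellLetters-kept X r d h with inShapeᵇ la mu (suc r) d in e
  ... | false = refl
  ... | true rewrite ≡ᵇ-false {X (suc r) d} {X r d} (h (inShapeᵇ-sound {la} {mu} e)) = refl

  cellLetters-skipped : ∀ X r d → InShape la mu (suc r) d → X (suc r) d ≡ X r d → cellLetters X r d ≡ []
  cellLetters-skipped X r d h e rewrite inShapeᵇ-true {la} {mu} h | ≡ᵇ-true e = refl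

  cellLetters-cong : ∀ X Y r d → X r d ≡ Y r d → X (suc r) d ≡ Y (suc r) d → cellLetters X r d ≡ cellLetters Y r d
  cellLetters-cong X Y r d e1 e2 rewrite e1 | e2 = refl

  rowLen : ℕ → ℕ
  rowLen r = at la r ∸ at mu r

  readRow-cells : ∀ X r → readRow la mu X r ≡ concatMap (cellLetters X r) (range (at mu r) (rowLen r))
  readRow-cells X r = cong (concatMap (cellLetters X r)) (shifted-upTo (at mu r) (rowLen r))

  inRow : ∀ r d → at mu r ≤ d → d < at mu r + rowLen r → InShape la mu r d
  inRow r d h1 h2 with at mu r ≤? at la r
  ... | yes le = h1 , subst (d <_) (m+[n∸m]≡n le) h2
  ... | no nle = ⊥-elim (<-irrefl refl (<-≤-trans h2 (subst (_≤ d) (sym (trans (cong (at mu r +_) (m≤n⇒m∸n≡0 (<⇒≤ (≰⇒> nle)))) (+-identityʳ _))) h1)))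

  notInRow : ∀ r d → ¬ (at mu r ≤ d × d < at mu r + rowLen r) → ¬ InShape la mu r d
  notInRow r d h (h1 , h2) = h (h1 , <-≤-trans h2 (m≤n+m∸n (at la r) (at mu r)))

  readRow-cong : ∀ X Y r → (∀ d → InShape la mu r d → cellLetters X r d ≡ cellLetters Y r d) → readRow la mu X r ≡ readRow la mu Y r
  readRow-cong X Y r h = trans (readRow-cells X r)
    (trans (concatMap-cong-range _ _ (at mu r) (rowLen r) (λ d h1 h2 → h d (inRow r d h1 h2))) (sym (readRow-cells Y r)))

  readRows : Filling → ℕ → ℕ → List ℕ
  readRows X s zero = []
  readRows X s (suc k) = readRow la mu X (s + k) ++ readRows X s k

  reading-rows : ∀ X → reading la mu X ≡ readRows X 0 L
  reading-rows X = go L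
    where
    go : ∀ n → concatMap (readRow la mu X) (downFrom n) ≡ readRows X 0 n
    go zero = refl
    go (suc n) = cong (readRow la mu X n ++_) (go n)

  readRows-split : ∀ X s k j → readRows X s (k + j) ≡ readRows X (s + j) k ++ readRows X s j
  readRows-split X s zero j = refl
  readRows-split X s (suc k) j = trans (cong₂ (λ a b → readRow la mu X a ++ b) (e s k j) (readRows-split X s k j)) (sym (++-assoc (readRow la mu X (s + j + k)) _ _))
    where e : ∀ s k j → s + (k + j) ≡ s + j + k
          e = solve-∀

  readRows-cong : ∀ X Y s k → (∀ r → s ≤ r → r < s + k → readRow la mu X r ≡ readRow la mu Y r) → readRows X s k ≡ readRows Y s k
  readRows-cong X Y s zero h = refl
  readRows-cong X Y s (suc k) h = cong₂ _++_ (h (s + k) (m≤m+n s k) (subst (s + k <_) (sym (+-suc s k)) ≤-refl))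
    (readRows-cong X Y s k (λ r h1 h2 → h r h1 (<-trans h2 (subst (s + k <_) (sym (+-suc s k)) ≤-refl))))

  reading-cong : ∀ X Y → (∀ r d → X r d ≡ Y r d) → reading la mu X ≡ reading la mu Y
  reading-cong X Y h = trans (reading-rows X) (trans (readRows-cong X Y 0 L (λ r _ _ →
    readRow-cong X Y r (λ d _ → cellLetters-cong X Y r d (h r d) (h (suc r) d)))) (sym (reading-rows Y)))

count : ℕ → List ℕ → ℕ
count v [] = 0
count v (x ∷ w) = (if x ≡ᵇ v then 1 else 0) + count v w

count-++ : ∀ v xs ys → count v (xs ++ ys) ≡ count v xs + count v ys
count-++ v [] ys = refl
count-++ v (x ∷ xs) ys = trans (cong ((if x ≡ᵇ v then 1 else 0) +_) (count-++ v xs ys)) (sym (+-assoc (if x ≡ᵇ v then 1 else 0) (count v xs) (count v ys)))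

#opn-letters : ∀ i w → #opn (map (letterParen i) w) ≡ count (suc i) w
#opn-letters i [] = refl
#opn-letters i (x ∷ w) with x ≡ᵇ i in e1 | x ≡ᵇ suc i in e2
... | true | true = ⊥-elim (i≢1+i i (trans (sym (≡ᵇ-sound {x} {i} e1)) (≡ᵇ-sound {x} {suc i} e2)))
... | true | false = #opn-letters i w
... | false | true = cong suc (#opn-letters i w)
... | false | false = #opn-letters i w

#cls-letters : ∀ i w → #cls (map (letterParen i) w) ≡ count i w
#cls-letters i [] = refl
#cls-letters i (x ∷ w) with x ≡ᵇ i in e1 | x ≡ᵇ suc i in e2
... | true | true = ⊥-elim (i≢1+i i (trans (sym (≡ᵇ-sound {x} {i} e1)) (≡ᵇ-sound {x} {suc i} e2)))
... | true | false = cong suc (#cls-letters i w)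
... | false | true = #cls-letters i w
... | false | false = #cls-letters i w

-- Scanning r T bottom-up, a value v is
-- read in a column exactly when it occurs there for the first time from
-- below; so a prefix ending in row r just before column q contains one v for
-- each column in which v occurs in the staircase region
-- { rows > r } ∪ { (r , d) | d < q }.
module PrefixCounts {la mu : List ℕ} (sh : SkewShape la mu) {m : ℕ} (T : Filling) (rpp : RPP la mu m T) where
  open ReadingWord la mu
  open Geometry {la} {mu} sh
  open Monotone {la} {mu} sh {m} {T} rpp

  HasFrom : ℕ → ℕ → ℕ → Set
  HasFrom v d t = Σ ℕ λ r → t ≤ r × InShape la mu r d × T r d ≡ v

  hasFromᵇ : ℕ → ℕ → ℕ → Bool
  hasFromᵇ v d t = any (λ r → (t ≤ᵇ r) ∧ (inShapeᵇ la mu r d ∧ (T r d ≡ᵇ v))) (range 0 L)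

  hasFromᵇ-sound : ∀ v d t → hasFromᵇ v d t ≡ true → HasFrom v d t
  hasFromᵇ-sound v d t e with any-range-sound _ 0 L e
  ... | r , _ , _ , h = r , ≤ᵇ-sound (∧-elimˡ h) , inShapeᵇ-sound {la} {mu} (∧-elimˡ (∧-elimʳ {t ≤ᵇ r} h)) , ≡ᵇ-sound {T r d} {v} (∧-elimʳ (∧-elimʳ {t ≤ᵇ r} h))

  hasFromᵇ-true : ∀ v d t → HasFrom v d t → hasFromᵇ v d t ≡ true
  hasFromᵇ-true v d t (r , h1 , h2 , h3) = any-range-true _ 0 L r z≤n (row<length h2) (∧-intro (≤ᵇ-true h1) (∧-intro (inShapeᵇ-true {la} {mu} h2) (≡ᵇ-true h3)))

  hasFromᵇ-false : ∀ v d t → ¬ HasFrom v d t → hasFromᵇ v d t ≡ false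
  hasFromᵇ-false v d t ne with hasFromᵇ v d t in eq
  ... | true = ⊥-elim (ne (hasFromᵇ-sound v d t eq))
  ... | false = refl

  occ : ℕ → ℕ → ℕ → ℕ
  occ v d t = if hasFromᵇ v d t then 1 else 0

  occ-1 : ∀ {v d t} → HasFrom v d t → occ v d t ≡ 1
  occ-1 {v} {d} {t} h rewrite hasFromᵇ-true v d t h = refl

  occ-0 : ∀ {v d t} → ¬ HasFrom v d t → occ v d t ≡ 0
  occ-0 {v} {d} {t} h rewrite hasFromᵇ-false v d t h = refl

  occ-cong : ∀ {v d t t'} → (HasFrom v d t → HasFrom v d t') → (HasFrom v d t' → HasFrom v d t) → occ v d t ≡ occ v d t'
  occ-cong {v} {d} {t} {t'} f g = cong (λ b → if b then 1 else 0)
    (bool-ext (λ e → hasFromᵇ-true v d t' (f (hasFromᵇ-sound v d t e))) (λ e → hasFromᵇ-true v d t (g (hasFromᵇ-sound v d t' e))))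

  from-suc : ∀ {v d r} → HasFrom v d (suc r) → HasFrom v d r
  from-suc (r' , h1 , h2 , h3) = r' , <⇒≤ h1 , h2 , h3

  from-split : ∀ {v d r} → HasFrom v d r → (InShape la mu r d × T r d ≡ v) ⊎ HasFrom v d (suc r)
  from-split {r = r} (r' , h1 , h2 , h3) with r ≟ r'
  ... | yes refl = inj₁ (h2 , h3)
  ... | no ne = inj₂ (r' , ≤∧≢⇒< h1 ne , h2 , h3)

  occ-skip : ∀ v r d → ¬ InShape la mu r d → occ v d r ≡ occ v d (suc r)
  occ-skip v r d ns = occ-cong (λ h → case from-split h of λ where
    (inj₁ (ins , _)) → ⊥-elim (ns ins)
    (inj₂ x) → x) from-suc

  kept-lowest : ∀ v r d → InShape la mu r d → (inShapeᵇ la mu (suc r) d ∧ (T (suc r) d ≡ᵇ T r d)) ≡ false → T r d ≡ v → ¬ HasFrom v d (suc r)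
  kept-lowest v r d ins kept tv (r' , h1 , h2 , h3) =
    let ins' = column-convex ins h2 (n≤1+n r) h1
        below = squeeze {T r d} {T (suc r) d} {T r' d} (col-mono ins ins' (n≤1+n r)) (col-mono ins' h2 h1) tv h3
    in true≢false (trans (sym (∧-intro (inShapeᵇ-true {la} {mu} ins') (≡ᵇ-true (trans below (sym tv))))) kept)

  occ-step : ∀ v r d → InShape la mu r d → occ v d r ≡ count v (cellLetters T r d) + occ v d (suc r)
  occ-step v r d ins with inShapeᵇ la mu (suc r) d ∧ (T (suc r) d ≡ᵇ T r d) in ec
  ... | true = occ-cong (λ h → case from-split h of λ where
          (inj₁ (_ , e)) → suc r , ≤-refl , inShapeᵇ-sound {la} {mu} (∧-elimˡ ec) , trans (≡ᵇ-sound {T (suc r) d} {T r d} (∧-elimʳ {inShapeᵇ la mu (suc r) d} ec)) e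
          (inj₂ x) → x) from-suc
  ... | false with T r d ≡ᵇ v in ev
  ... | true rewrite occ-1 {v} {d} {r} (r , ≤-refl , ins , ≡ᵇ-sound {T r d} {v} ev) | occ-0 (kept-lowest v r d ins ec (≡ᵇ-sound {T r d} {v} ev)) = refl
  ... | false = occ-cong (λ h → case from-split h of λ where
          (inj₁ (_ , e)) → ⊥-elim (true≢false (trans (sym (≡ᵇ-true e)) ev))
          (inj₂ x) → x) from-suc

  -- the staircase region counts column d from row r if d < q, from row r + 1 otherwise
  threshold : ℕ → ℕ → ℕ → ℕ
  threshold r q d = if d <ᵇ q then r else suc r

  threshold-lt : ∀ r q d → d < q → threshold r q d ≡ r
  threshold-lt r q d h rewrite <ᵇ-true h = refl

  threshold-ge : ∀ r q d → q ≤ d → threshold r q d ≡ suc r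
  threshold-ge r q d h rewrite <ᵇ-false {d} {q} h = refl

  threshold-≥ : ∀ r q d → r ≤ threshold r q d
  threshold-≥ r q d with d <ᵇ q
  ... | true = ≤-refl
  ... | false = n≤1+n r

  threshold-mono : ∀ r q d d' → d' ≤ d → threshold r q d' ≤ threshold r q d
  threshold-mono r q d d' le with d <? q | d' <? q
  ... | yes a | yes b rewrite threshold-lt r q d a | threshold-lt r q d' b = ≤-refl
  ... | yes a | no b = ⊥-elim (b (≤-<-trans le a))
  ... | no a | yes b rewrite threshold-ge r q d (≮⇒≥ a) | threshold-lt r q d' b = n≤1+n r
  ... | no a | no b rewrite threshold-ge r q d (≮⇒≥ a) | threshold-ge r q d' (≮⇒≥ b) = ≤-refl

  regionCount : ℕ → ℕ → ℕ → ℕ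
  regionCount v r q = sumRange (λ d → occ v d (threshold r q d)) 0 W

  rowsCount : ℕ → ℕ → ℕ
  rowsCount v s = sumRange (λ d → occ v d s) 0 W

  regionCount-full : ∀ v s → regionCount v s W ≡ rowsCount v s
  regionCount-full v s = sumRange-cong _ _ 0 W (λ d _ h → cong (occ v d) (threshold-lt s W d h))

  rowsCount-beyond : ∀ v → rowsCount v L ≡ 0
  rowsCount-beyond v = sumRange-zero _ 0 W (λ d _ _ → occ-0 (λ { (r , h1 , h2 , h3) → <-irrefl refl (<-≤-trans (row<length h2) h1) }))

  region-step : ∀ v r q → InShape la mu r q → regionCount v r q + count v (cellLetters T r q) ≡ regionCount v r (suc q)
  region-step v r q ins = +-cancelʳ-≡ (occ v q (suc r)) _ _ (begin
      (regionCount v r q + count v (cellLetters T r q)) + occ v q (suc r)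
        ≡⟨ +-assoc (regionCount v r q) _ _ ⟩
      regionCount v r q + (count v (cellLetters T r q) + occ v q (suc r))
        ≡⟨ cong (regionCount v r q +_) (sym (occ-step v r q ins)) ⟩
      regionCount v r q + occ v q r
        ≡⟨ cong (λ z → regionCount v r q + occ v q z) (sym (threshold-lt r (suc q) q ≤-refl)) ⟩
      regionCount v r q + occ v q (threshold r (suc q) q)
        ≡⟨ sym (sumRange-point (λ d → occ v d (threshold r (suc q) d)) (λ d → occ v d (threshold r q d)) 0 W q z≤n (col<width ins) (λ d ne → cong (occ v d) (corner-moved d ne))) ⟩
      regionCount v r (suc q) + occ v q (threshold r q q)
        ≡⟨ cong (λ z → regionCount v r (suc q) + occ v q z) (threshold-ge r q q ≤-refl) ⟩
      regionCount v r (suc q) + occ v q (suc r) ∎)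
    where
    open ≡-Reasoning
    corner-moved : ∀ d → ¬ d ≡ q → threshold r (suc q) d ≡ threshold r q d
    corner-moved d ne with d <? q
    ... | yes a rewrite threshold-lt r q d a | threshold-lt r (suc q) d (m<n⇒m<1+n a) = refl
    ... | no a rewrite threshold-ge r q d (≮⇒≥ a) | threshold-ge r (suc q) d (≤∧≢⇒< (≮⇒≥ a) (λ e → ne (sym e))) = refl

  rowPrefix-count : ∀ v r j → j ≤ rowLen r →
    count v (concatMap (cellLetters T r) (range (at mu r) j)) + rowsCount v (suc r) ≡ regionCount v r (at mu r + j)
  rowPrefix-count v r zero h = sumRange-cong _ _ 0 W (λ d _ _ → lem d)
    where
    lem : ∀ d → occ v d (suc r) ≡ occ v d (threshold r (at mu r + 0) d)
    lem d with d <? at mu r + 0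
    ... | yes a rewrite threshold-lt r _ d a = sym (occ-skip v r d (notInRow r d (λ (h1 , _) → <-irrefl refl (<-≤-trans (subst (d <_) (+-identityʳ _) a) h1))))
    ... | no a rewrite threshold-ge r _ d (≮⇒≥ a) = refl
  rowPrefix-count v r (suc j) h = begin
      count v (concatMap C (range a (suc j))) + rowsCount v (suc r)
        ≡⟨ cong (λ z → count v z + rowsCount v (suc r)) cells ⟩
      count v (P ++ (C q ++ [])) + rowsCount v (suc r)
        ≡⟨ cong (_+ rowsCount v (suc r)) (trans (count-++ v P _) (cong (λ z → count v P + count v z) (++-identityʳ (C q)))) ⟩
      (count v P + count v (C q)) + rowsCount v (suc r)
        ≡⟨ +-exchange (count v P) _ _ ⟩
      (count v P + rowsCount v (suc r)) + count v (C q)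
        ≡⟨ cong (_+ count v (C q)) (rowPrefix-count v r j (<⇒≤ h)) ⟩
      regionCount v r q + count v (C q)
        ≡⟨ region-step v r q (inRow r q (m≤m+n _ j) (+-monoʳ-< a h)) ⟩
      regionCount v r (suc q)
        ≡⟨ cong (regionCount v r) (sym (+-suc a j)) ⟩
      regionCount v r (a + suc j) ∎
    where
    open ≡-Reasoning
    a = at mu r
    q = a + j
    C = cellLetters T r
    P = concatMap C (range a j)
    cells : concatMap C (range a (suc j)) ≡ P ++ (C q ++ [])
    cells = trans (cong (λ z → concatMap C (range a z)) (+-comm 1 j)) (trans (cong (concatMap C) (range-++ a j 1)) (concatMap-++ C (range a j) [ q ]))

  row-count : ∀ v r → count v (readRow la mu T r) + rowsCount v (suc r) ≡ rowsCount v r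
  row-count v r = trans (cong (λ z → count v z + rowsCount v (suc r)) (readRow-cells T r))
    (trans (rowPrefix-count v r (rowLen r) ≤-refl) (sumRange-cong _ _ 0 W (λ d _ _ → lem d)))
    where
    lem : ∀ d → occ v d (threshold r (at mu r + rowLen r) d) ≡ occ v d r
    lem d with d <? at mu r + rowLen r
    ... | yes a rewrite threshold-lt r _ d a = refl
    ... | no a rewrite threshold-ge r _ d (≮⇒≥ a) = sym (occ-skip v r d (notInRow r d (λ (_ , h2) → a h2)))

  rows-count : ∀ v s k → count v (readRows T s k) + rowsCount v (s + k) ≡ rowsCount v s
  rows-count v s zero = cong (rowsCount v) (+-identityʳ s)
  rows-count v s (suc k) = begin
      count v (readRow la mu T (s + k) ++ readRows T s k) + rowsCount v (s + suc k)
        ≡⟨ cong₂ _+_ (count-++ v (readRow la mu T (s + k)) (readRows T s k)) (cong (rowsCount v) (+-suc s k)) ⟩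
      (count v (readRow la mu T (s + k)) + count v (readRows T s k)) + rowsCount v (suc (s + k))
        ≡⟨ +-rotate (count v (readRow la mu T (s + k))) _ _ ⟩
      count v (readRows T s k) + (count v (readRow la mu T (s + k)) + rowsCount v (suc (s + k)))
        ≡⟨ cong (count v (readRows T s k) +_) (row-count v (s + k)) ⟩
      count v (readRows T s k) + rowsCount v (s + k)
        ≡⟨ rows-count v s k ⟩
      rowsCount v s ∎
    where open ≡-Reasoning

  rowPrefix-take : ∀ r n j → j ≤ rowLen r → Σ ℕ λ j' → j' ≤ j ×
    take n (concatMap (cellLetters T r) (range (at mu r) j)) ≡ concatMap (cellLetters T r) (range (at mu r) j')
  rowPrefix-take r n j jle with take-concatMap (cellLetters T r) (cellLetters-length T r) n (range (at mu r) j)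
  ... | j' , h , e = j' , j'le , trans e (cong (concatMap (cellLetters T r)) (take-range _ j' j j'le))
    where j'le = subst (j' ≤_) (length-range _ _) h

  rowsPrefix-count : ∀ s k n → Σ ℕ λ r → Σ ℕ λ q → s ≤ r × (∀ v → count v (take n (readRows T s k)) + rowsCount v (s + k) ≡ regionCount v r q)
  rowsPrefix-count s zero n = s , W , ≤-refl , λ v → trans (cong₂ (λ a b → count v a + rowsCount v b) (take-[] n) (+-identityʳ s)) (sym (regionCount-full v s))
  rowsPrefix-count s (suc k) n with n ≤? length (readRow la mu T (s + k))
  ... | yes le with rowPrefix-take (s + k) n (rowLen (s + k)) ≤-refl
  ... | j , jle , tk = s + k , at mu (s + k) + j , m≤m+n s k , λ v →
        trans (cong₂ (λ a b → count v a + rowsCount v b) (trans (take-++-≤ n (readRow la mu T (s + k)) _ le)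
          (trans (cong (take n) (readRow-cells T (s + k))) tk)) (+-suc s k)) (rowPrefix-count v (s + k) j jle)
  rowsPrefix-count s (suc k) n | no nle with rowsPrefix-count s k (n ∸ length (readRow la mu T (s + k)))
  ... | r , q , sr , h = r , q , sr , λ v → begin
          count v (take n (A ++ B)) + rowsCount v (s + suc k)
            ≡⟨ cong₂ (λ a b → count v a + rowsCount v b) tk (+-suc s k) ⟩
          count v (A ++ take n' B) + rowsCount v (suc (s + k))
            ≡⟨ cong (_+ rowsCount v (suc (s + k))) (count-++ v A (take n' B)) ⟩
          (count v A + count v (take n' B)) + rowsCount v (suc (s + k))
            ≡⟨ +-rotate (count v A) _ _ ⟩
          count v (take n' B) + (count v A + rowsCount v (suc (s + k)))
            ≡⟨ cong (count v (take n' B) +_) (row-count v (s + k)) ⟩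
          count v (take n' B) + rowsCount v (s + k)
            ≡⟨ h v ⟩
          regionCount v r q ∎
    where
    open ≡-Reasoning
    A = readRow la mu T (s + k)
    B = readRows T s k
    n' = n ∸ length A
    tk : take n (A ++ B) ≡ A ++ take n' B
    tk = trans (cong (λ z → take z (A ++ B)) (sym (m+[n∸m]≡n (<⇒≤ (≰⇒> nle))))) (take-++-+ n' A B)

  prefix-count : ∀ n → Σ ℕ λ r → Σ ℕ λ q → ∀ v → count v (take n (reading la mu T)) ≡ regionCount v r q
  prefix-count n with rowsPrefix-count 0 L n
  ... | r , q , _ , h = r , q , λ v → trans (cong (λ z → count v (take n z)) (reading-rows T))
    (trans (sym (+-identityʳ _)) (trans (cong (count v (take n (readRows T 0 L)) +_) (sym (rowsCount-beyond v))) (h v)))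

module Columns {la mu : List ℕ} (sh : SkewShape la mu) where
  open Geometry {la} {mu} sh

  ColumnHas : Filling → ℕ → ℕ → Set
  ColumnHas X d v = Σ ℕ λ r → InShape la mu r d × X r d ≡ v

  private
    cellIs : Filling → ℕ → ℕ → ℕ → Bool
    cellIs X d v r = inShapeᵇ la mu r d ∧ (X r d ≡ᵇ v)

    parenOf : Bool → Bool → Paren
    parenOf a b = if a ∧ not b then cls else (if not a ∧ b then opn else non)

  hasVal-sound : ∀ X d v → hasVal la mu X d v ≡ true → ColumnHas X d v
  hasVal-sound X d v e with any-range-sound (cellIs X d v) 0 (length la) (subst (λ z → any (cellIs X d v) z ≡ true) (upTo-range (length la)) e)
  ... | r , _ , _ , h = r , inShapeᵇ-sound {la} {mu} (∧-elimˡ h) , ≡ᵇ-sound {X r d} {v} (∧-elimʳ {inShapeᵇ la mu r d} h)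

  hasVal-true : ∀ X d v → ColumnHas X d v → hasVal la mu X d v ≡ true
  hasVal-true X d v (r , h1 , h2) = subst (λ z → any (cellIs X d v) z ≡ true) (sym (upTo-range (length la)))
    (any-range-true (cellIs X d v) 0 (length la) r z≤n (row<length h1) (∧-intro (inShapeᵇ-true {la} {mu} h1) (≡ᵇ-true h2)))

  hasVal-false : ∀ X d v → ¬ ColumnHas X d v → hasVal la mu X d v ≡ false
  hasVal-false X d v ne with hasVal la mu X d v in e
  ... | true = ⊥-elim (ne (hasVal-sound X d v e))
  ... | false = refl

  data ColumnKind (i : ℕ) (X : Filling) (d : ℕ) : Set where
    i-pure : colParen la mu i X d ≡ cls → ColumnHas X d i → ¬ ColumnHas X d (suc i) → ColumnKind i X d
    next-pure : colParen la mu i X d ≡ opn → ¬ ColumnHas X d i → ColumnHas X d (suc i) → ColumnKind i X d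
    mixed-col : colParen la mu i X d ≡ non → ColumnHas X d i → ColumnHas X d (suc i) → ColumnKind i X d
    empty-col : colParen la mu i X d ≡ non → ¬ ColumnHas X d i → ¬ ColumnHas X d (suc i) → ColumnKind i X d

  columnKind : ∀ i X d → ColumnKind i X d
  columnKind i X d with hasVal la mu X d i in e1 | hasVal la mu X d (suc i) in e2
  ... | true | true = mixed-col (cong₂ parenOf e1 e2) (hasVal-sound X d i e1) (hasVal-sound X d (suc i) e2)
  ... | true | false = i-pure (cong₂ parenOf e1 e2) (hasVal-sound X d i e1) (λ h → true≢false (trans (sym (hasVal-true X d (suc i) h)) e2))
  ... | false | true = next-pure (cong₂ parenOf e1 e2) (λ h → true≢false (trans (sym (hasVal-true X d i h)) e1)) (hasVal-sound X d (suc i) e2)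
  ... | false | false = empty-col (cong₂ parenOf e1 e2) (λ h → true≢false (trans (sym (hasVal-true X d i h)) e1)) (λ h → true≢false (trans (sym (hasVal-true X d (suc i) h)) e2))

  cls⇒no-next : ∀ {i X d} → colParen la mu i X d ≡ cls → ¬ ColumnHas X d (suc i)
  cls⇒no-next {i} {X} {d} e with columnKind i X d
  ... | i-pure _ _ h = h
  ... | next-pure e' _ _ = λ _ → case trans (sym e') e of λ ()
  ... | mixed-col e' _ _ = λ _ → case trans (sym e') e of λ ()
  ... | empty-col e' _ _ = λ _ → case trans (sym e') e of λ ()

  cls⇒has-i : ∀ {i X d} → colParen la mu i X d ≡ cls → ColumnHas X d i
  cls⇒has-i {i} {X} {d} e with columnKind i X d
  ... | i-pure _ h _ = h
  ... | next-pure e' _ _ = case trans (sym e') e of λ ()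
  ... | mixed-col e' _ _ = case trans (sym e') e of λ ()
  ... | empty-col e' _ _ = case trans (sym e') e of λ ()

  lowestI : ℕ → Filling → ℕ → ℕ
  lowestI i X d = maxBelow (λ r → inShapeᵇ la mu r d ∧ (X r d ≡ᵇ i)) (length la)

  lowestI-spec : ∀ i X d → ColumnHas X d i → LowestI la mu i X d (lowestI i X d)
  lowestI-spec i X d (r0 , h1 , h2) with maxBelow-spec (λ r → inShapeᵇ la mu r d ∧ (X r d ≡ᵇ i)) (length la) (r0 , row<length h1 , ∧-intro (inShapeᵇ-true {la} {mu} h1) (≡ᵇ-true h2))
  ... | a , b = inShapeᵇ-sound {la} {mu} (∧-elimˡ a) , ≡ᵇ-sound {X (lowestI i X d) d} {i} (∧-elimʳ {inShapeᵇ la mu (lowestI i X d) d} a) ,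
                λ r h3 h4 → b r (row<length h3) (∧-intro (inShapeᵇ-true {la} {mu} h3) (≡ᵇ-true h4))

#opn-map-range : ∀ (f : ℕ → Paren) a n → #opn (map f (range a n)) ≡ sumRange (λ d → #opn (f d ∷ [])) a n
#opn-map-range f a zero = refl
#opn-map-range f a (suc n) = trans (lem (f a) _) (cong (#opn (f a ∷ []) +_) (#opn-map-range f (suc a) n))
  where lem : ∀ x xs → #opn (x ∷ xs) ≡ #opn (x ∷ []) + #opn xs
        lem opn xs = refl
        lem cls xs = refl
        lem non xs = refl

#cls-map-range : ∀ (f : ℕ → Paren) a n → #cls (map f (range a n)) ≡ sumRange (λ d → #cls (f d ∷ [])) a n
#cls-map-range f a zero = refl
#cls-map-range f a (suc n) = trans (lem (f a) _) (cong (#cls (f a ∷ []) +_) (#cls-map-range f (suc a) n))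
  where lem : ∀ x xs → #cls (x ∷ xs) ≡ #cls (x ∷ []) + #cls xs
        lem opn xs = refl
        lem cls xs = refl
        lem non xs = refl

module ColumnWord (la mu : List ℕ) (i : ℕ) (X : Filling) where
  open ReadingWord la mu using (W)

  cw = colWord la mu i X

  opnCol clsCol : ℕ → ℕ
  opnCol d = #opn (colParen la mu i X d ∷ [])
  clsCol d = #cls (colParen la mu i X d ∷ [])

  colWord-range : cw ≡ map (colParen la mu i X) (range 0 W)
  colWord-range = cong (map _) (upTo-range W)

  colWord-take : ∀ δ → δ ≤ W → take δ cw ≡ map (colParen la mu i X) (range 0 δ)
  colWord-take δ h = trans (cong (take δ) colWord-range) (trans (take-map δ (range 0 W)) (cong (map _) (take-range 0 δ W h)))

  colWord-drop : ∀ j → drop j cw ≡ map (colParen la mu i X) (range j (W ∸ j))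
  colWord-drop j = trans (cong (drop j) colWord-range) (trans (drop-map j (range 0 W)) (cong (map _) (drop-range 0 j W)))

  #opn-colWord : ∀ δ → δ ≤ W → #opn (take δ cw) ≡ sumRange opnCol 0 δ
  #opn-colWord δ h = trans (cong #opn (colWord-take δ h)) (#opn-map-range _ 0 δ)

  #cls-colWord : ∀ δ → δ ≤ W → #cls (take δ cw) ≡ sumRange clsCol 0 δ
  #cls-colWord δ h = trans (cong #cls (colWord-take δ h)) (#cls-map-range _ 0 δ)

  colWord-at : ∀ (U V : List Paren) x → cw ≡ U ++ x ∷ V → length U < W × colParen la mu i X (length U) ≡ x
  colWord-at U V x e = lt , head-eq (trans (sym (trans (colWord-drop (length U)) (cong (map _) (range-head lt)))) (trans (cong (drop (length U)) e) (drop-++-length U)))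
    where
    len : length cw ≡ W
    len = trans (cong length colWord-range) (trans (length-map _ (range 0 W)) (length-range 0 W))
    lt : length U < W
    lt = subst (length U <_) (trans (sym (length-++ U)) (trans (cong length (sym e)) len)) (m<m+n (length U) (s≤s z≤n))
    range-head : ∀ {j n} → j < n → range j (n ∸ j) ≡ j ∷ range (suc j) (n ∸ suc j)
    range-head {j} {n} h = cong (range j) (+-∸-assoc 1 h)
    drop-++-length : ∀ (U : List Paren) {V} → drop (length U) (U ++ V) ≡ V
    drop-++-length [] = refl
    drop-++-length (y ∷ U) = drop-++-length U
    head-eq : ∀ {a b : Paren} {xs ys} → a ∷ xs ≡ b ∷ ys → a ≡ b
    head-eq refl = refl

-- For a staircase region R, let δ be one past the last
-- column meeting R in an i or i + 1.  Columns of the i/(i+1) sub-filling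
-- that meet the band {i , i+1} to the left of δ meet R as well, so comparing
-- column by column: #(i's read in R) + #(opening brackets among the first δ
-- columns) ≤ #(i+1's read in R) + #(closing brackets among them).
module RegionBound {la mu : List ℕ} (sh : SkewShape la mu) {m : ℕ} (i : ℕ) (T : Filling) (rpp : RPP la mu m T) where
  open ReadingWord la mu
  open Geometry {la} {mu} sh
  open Monotone {la} {mu} sh {m} {T} rpp
  open PrefixCounts {la} {mu} sh {m} T rpp
  open Columns {la} {mu} sh
  open ColumnWord la mu i T

  Meets : ℕ → Set
  Meets d = ColumnHas T d i ⊎ ColumnHas T d (suc i)

  Touches : ℕ → ℕ → Set
  Touches d t = HasFrom (suc i) d t ⊎ HasFrom i d t

  InBand : ℕ → ℕ → Set
  InBand d t = Σ ℕ λ r → t ≤ r × InShape la mu r d × i ≤ T r d × T r d ≤ suc i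

  band⇒touches : ∀ {d t} → InBand d t → Touches d t
  band⇒touches (r , h1 , h2 , h3 , h4) with between-i-1+i (T r _) h3 h4
  ... | inj₁ e = inj₂ (r , h1 , h2 , e)
  ... | inj₂ e = inj₁ (r , h1 , h2 , e)

  touches⇒band : ∀ {d t} → Touches d t → InBand d t
  touches⇒band (inj₁ (r , h1 , h2 , h3)) = r , h1 , h2 , ≤-trans (n≤1+n i) (≤-reflexive (sym h3)) , ≤-reflexive h3
  touches⇒band (inj₂ (r , h1 , h2 , h3)) = r , h1 , h2 , ≤-reflexive (sym h3) , ≤-trans (≤-reflexive h3) (n≤1+n i)

  meets⇒band : ∀ {d} → Meets d → InBand d 0
  meets⇒band (inj₁ (r , h1 , h2)) = r , z≤n , h1 , ≤-reflexive (sym h2) , ≤-trans (≤-reflexive h2) (n≤1+n i)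
  meets⇒band (inj₂ (r , h1 , h2)) = r , z≤n , h1 , ≤-trans (n≤1+n i) (≤-reflexive (sym h2)) , ≤-reflexive h2

  no-from : ∀ {v d t} → ¬ ColumnHas T d v → ¬ HasFrom v d t
  no-from nh (r , _ , h2 , h3) = nh (r , h2 , h3)

  -- in a column with an i + 1, the i + 1's lie below every i
  next-below : ∀ {d t} → ColumnHas T d (suc i) → HasFrom i d t → HasFrom (suc i) d t
  next-below (z , hz1 , hz2) (y , hy0 , hy1 , hy2) with z ≤? y
  ... | yes le = ⊥-elim (<-irrefl refl (subst₂ _≤_ hz2 hy2 (col-mono hz1 hy1 le)))
  ... | no nle = z , ≤-trans hy0 (<⇒≤ (≰⇒> nle)) , hz1 , hz2

  touch-left : ∀ {d d' t t'} → d' ≤ d → t' ≤ t → Touches d t → Meets d' → Touches d' t'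
  touch-left {d} {d'} {t} {t'} dle tle tch mt with touches⇒band tch | meets⇒band mt
  ... | r , a1 , a2 , a3 , a4 | y , _ , b1 , b2 , b3 with r ≤? y
  ... | yes le = band⇒touches (y , ≤-trans tle (≤-trans a1 le) , b1 , b2 , b3)
  ... | no nle = band⇒touches (r , ≤-trans tle a1 , ins , ≤-trans b2 (col-mono b1 ins y≤r) , ≤-trans (row-mono ins a2 dle) a4)
    where
    y≤r = <⇒≤ (≰⇒> nle)
    ins = corner b1 a2 y≤r dle

  occ-≤1 : ∀ v d t → occ v d t ≤ 1
  occ-≤1 v d t with hasFromᵇ v d t
  ... | true = ≤-refl
  ... | false = z≤n

  column-bound : ∀ δ d t → (d < δ → Meets d → Touches d t) → (δ ≤ d → ¬ Touches d t) →
    occ i d t + below δ d (opnCol d) ≤ occ (suc i) d t + below δ d (clsCol d)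
  column-bound δ d t inside outside with d <? δ
  ... | no ge rewrite below-ge {δ} {d} (opnCol d) (≮⇒≥ ge) | below-ge {δ} {d} (clsCol d) (≮⇒≥ ge) | occ-0 {i} {d} {t} (λ x → outside (≮⇒≥ ge) (inj₂ x)) = z≤n
  ... | yes lt rewrite below-lt {δ} {d} (opnCol d) lt | below-lt {δ} {d} (clsCol d) lt with columnKind i T d
  ...   | i-pure e _ _ rewrite e = ≤-trans (≤-reflexive (+-identityʳ _)) (≤-trans (occ-≤1 i d t) (m≤n+m 1 _))
  ...   | next-pure e ¬hi hn rewrite e | occ-0 {i} {d} {t} (no-from ¬hi) with inside lt (inj₂ hn)
  ...     | inj₁ x rewrite occ-1 x = ≤-refl
  ...     | inj₂ x = ⊥-elim (no-from ¬hi x)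
  column-bound δ d t inside outside | yes lt | mixed-col e _ hn rewrite e with hasFromᵇ i d t in eq
  ...     | false = z≤n
  ...     | true rewrite occ-1 (next-below hn (hasFromᵇ-sound i d t eq)) = ≤-refl
  column-bound δ d t inside outside | yes lt | empty-col e ¬hi _ rewrite e | occ-0 {i} {d} {t} (no-from ¬hi) = z≤n

  region-bound : ∀ r q → Σ ℕ λ δ → δ ≤ W ×
    (regionCount i r q + #opn (take δ cw) ≤ regionCount (suc i) r q + #cls (take δ cw)) ×
    (∀ c → Meets c → ¬ Touches c (threshold r q c) → δ ≤ c)
  region-bound r q = δ , δ≤W , ineq , before
    where
    touchesᵇ : ℕ → Bool
    touchesᵇ d = hasFromᵇ (suc i) d (threshold r q d) ∨ hasFromᵇ i d (threshold r q d)
    δ = lastTrue touchesᵇ W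
    δ≤W = lastTrue-≤ touchesᵇ W
    touchesᵇ-sound : ∀ d → touchesᵇ d ≡ true → Touches d (threshold r q d)
    touchesᵇ-sound d e with hasFromᵇ (suc i) d (threshold r q d) in e1
    ... | true = inj₁ (hasFromᵇ-sound _ _ _ e1)
    ... | false = inj₂ (hasFromᵇ-sound _ _ _ e)
    touchesᵇ-false : ∀ d → touchesᵇ d ≡ false → ¬ Touches d (threshold r q d)
    touchesᵇ-false d e (inj₁ x) = true≢false (trans (sym (cong (_∨ hasFromᵇ i d (threshold r q d)) (hasFromᵇ-true _ _ _ x))) e)
    touchesᵇ-false d e (inj₂ x) with hasFromᵇ (suc i) d (threshold r q d)
    ... | true = true≢false e
    ... | false = true≢false (trans (sym (hasFromᵇ-true _ _ _ x)) e)
    inside : ∀ d → d < δ → Meets d → Touches d (threshold r q d)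
    inside d lt mt with lastTrue-before touchesᵇ W d lt
    ... | e , h1 , _ , h3 = touch-left h1 (threshold-mono r q e d h1) (touchesᵇ-sound e h3) mt
    summed : sumRange (λ d → occ i d (threshold r q d) + below δ d (opnCol d)) 0 W ≤ sumRange (λ d → occ (suc i) d (threshold r q d) + below δ d (clsCol d)) 0 W
    summed = sumRange-mono _ _ 0 W (λ d _ dW → column-bound δ d _ (inside d) (λ ge → touchesᵇ-false d (lastTrue-after touchesᵇ W d ge dW)))
    totals : ∀ v f → sumRange (λ d → occ v d (threshold r q d) + below δ d (f d)) 0 W ≡ regionCount v r q + sumRange f 0 δ
    totals v f = trans (sumRange-+ _ _ 0 W) (cong (regionCount v r q +_) (sumRange-below f δ W δ≤W))
    ineq : regionCount i r q + #opn (take δ cw) ≤ regionCount (suc i) r q + #cls (take δ cw)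
    ineq = subst₂ _≤_ (trans (totals i opnCol) (cong (regionCount i r q +_) (sym (#opn-colWord δ δ≤W))))
                      (trans (totals (suc i) clsCol) (cong (regionCount (suc i) r q +_) (sym (#cls-colWord δ δ≤W)))) summed
    before : ∀ c → Meets c → ¬ Touches c (threshold r q c) → δ ≤ c
    before c mt nt with c <? δ
    ... | no nlt = ≮⇒≥ nlt
    ... | yes lt = ⊥-elim (nt (inside c lt mt))

isIorI1-true : ∀ i x → (x ≡ i ⊎ x ≡ suc i) → isIorI1 i x ≡ true
isIorI1-true i x (inj₁ e) rewrite ≡ᵇ-true e = refl
isIorI1-true i x (inj₂ e) rewrite ≡ᵇ-true e with x ≡ᵇ i
... | true = refl
... | false = refl

isIorI1-false : ∀ i x → ¬ (x ≡ i ⊎ x ≡ suc i) → isIorI1 i x ≡ false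
isIorI1-false i x ne with x ≡ᵇ i in e1 | x ≡ᵇ suc i in e2
... | true | _ = ⊥-elim (ne (inj₁ (≡ᵇ-sound {x} {i} e1)))
... | false | true = ⊥-elim (ne (inj₂ (≡ᵇ-sound {x} {suc i} e2)))
... | false | false = refl

module Edits (la mu : List ℕ) (i : ℕ) where
  InBandCell : Filling → ℕ → ℕ → Set
  InBandCell X r c = InShape la mu r c × (X r c ≡ i ⊎ X r c ≡ suc i)

  raise-other : ∀ c X r d → ¬ d ≡ c → raise la mu i c X r d ≡ X r d
  raise-other c X r d ne rewrite ≡ᵇ-false {d} {c} ne = refl

  raise-i : ∀ c X r → InShape la mu r c → X r c ≡ i → raise la mu i c X r c ≡ suc i
  raise-i c X r h e rewrite ≡ᵇ-true {c} {c} refl | inShapeᵇ-true {la} {mu} h | ≡ᵇ-true e = refl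

  raise-not-i : ∀ c X r → ¬ X r c ≡ i → raise la mu i c X r c ≡ X r c
  raise-not-i c X r ne rewrite ≡ᵇ-true {c} {c} refl | ∧-falseʳ {inShapeᵇ la mu r c} (≡ᵇ-false {X r c} {i} ne) = refl

  raise-outside : ∀ c X r → ¬ InShape la mu r c → raise la mu i c X r c ≡ X r c
  raise-outside c X r ne rewrite ≡ᵇ-true {c} {c} refl | inShapeᵇ-false {la} {mu} ne = refl

  setColAll-other : ∀ c v X r d → ¬ d ≡ c → setColAll la mu i c v X r d ≡ X r d
  setColAll-other c v X r d ne rewrite ≡ᵇ-false {d} {c} ne = refl

  setColAll-band : ∀ c v X r → InBandCell X r c → setColAll la mu i c v X r c ≡ v
  setColAll-band c v X r (h1 , h2) rewrite ≡ᵇ-true {c} {c} refl | inShapeᵇ-true {la} {mu} h1 | isIorI1-true i (X r c) h2 = refl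

  setColAll-off : ∀ c v X r → ¬ InBandCell X r c → setColAll la mu i c v X r c ≡ X r c
  setColAll-off c v X r ne rewrite ≡ᵇ-true {c} {c} refl with inShapeᵇ la mu r c in e1
  ... | false = refl
  ... | true rewrite isIorI1-false i (X r c) (λ h → ne (inShapeᵇ-sound {la} {mu} e1 , h)) = refl

  setColSplit-other : ∀ c l X r d → ¬ d ≡ c → setColSplit la mu i c l X r d ≡ X r d
  setColSplit-other c l X r d ne rewrite ≡ᵇ-false {d} {c} ne = refl

  setColSplit-band : ∀ c l X r → InBandCell X r c → setColSplit la mu i c l X r c ≡ (if r ≤ᵇ l then i else suc i)
  setColSplit-band c l X r (h1 , h2) rewrite ≡ᵇ-true {c} {c} refl | inShapeᵇ-true {la} {mu} h1 | isIorI1-true i (X r c) h2 = refl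

  setColSplit-off : ∀ c l X r → ¬ InBandCell X r c → setColSplit la mu i c l X r c ≡ X r c
  setColSplit-off c l X r ne rewrite ≡ᵇ-true {c} {c} refl with inShapeᵇ la mu r c in e1
  ... | false = refl
  ... | true rewrite isIorI1-false i (X r c) (λ h → ne (inShapeᵇ-sound {la} {mu} e1 , h)) = refl

  setColAll-cong : ∀ c v X Y → (∀ r d → X r d ≡ Y r d) → ∀ r d → setColAll la mu i c v X r d ≡ setColAll la mu i c v Y r d
  setColAll-cong c v X Y h r d rewrite h r d = refl

  setColSplit-cong : ∀ c l X Y → (∀ r d → X r d ≡ Y r d) → ∀ r d → setColSplit la mu i c l X r d ≡ setColSplit la mu i c l Y r d
  setColSplit-cong c l X Y h r d rewrite h r d = refl

  split-above : ∀ {r l} → r ≤ l → (if r ≤ᵇ l then i else suc i) ≡ i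
  split-above h rewrite ≤ᵇ-true h = refl

  split-below : ∀ {r l} → ¬ r ≤ l → (if r ≤ᵇ l then i else suc i) ≡ suc i
  split-below {r} {l} h with r ≤ᵇ l in e
  ... | true = ⊥-elim (h (≤ᵇ-sound e))
  ... | false = refl

  split-i⇒above : ∀ r l → (if r ≤ᵇ l then i else suc i) ≡ i → r ≤ l
  split-i⇒above r l e with r ≤ᵇ l in q
  ... | true = ≤ᵇ-sound q
  ... | false = ⊥-elim (i≢1+i i (sym e))

  split-next⇒below : ∀ r l → (if r ≤ᵇ l then i else suc i) ≡ suc i → ¬ r ≤ l
  split-next⇒below r l e h rewrite ≤ᵇ-true h = i≢1+i i e

  split-band : ∀ (b : Bool) → (if b then i else suc i) ≡ i ⊎ (if b then i else suc i) ≡ suc i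
  split-band true = inj₁ refl
  split-band false = inj₂ refl

-- Let column c give a closing bracket of the column
-- word and let b be its lowest row holding i.  Then the letter of cell (b , c)
-- splits the reading word as U ++ i ∷ V, raising column c only turns this
-- letter into i + 1, and the staircase region just before (b , c) is balanced
-- against the columns left of c.
module RaisedCell {la mu : List ℕ} (sh : SkewShape la mu) {m : ℕ} (i : ℕ) (T : Filling) (rpp : RPP la mu m T)
                  (c b : ℕ) (c<W : c < at la 0) (c-cls : colParen la mu i T c ≡ cls) (b-lowest : LowestI la mu i T c b) where
  open ReadingWord la mu
  open Geometry {la} {mu} sh
  open Monotone {la} {mu} sh {m} {T} rpp
  open PrefixCounts {la} {mu} sh {m} T rpp
  open Columns {la} {mu} sh
  open ColumnWord la mu i T
  open RegionBound {la} {mu} sh {m} i T rpp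
  open Edits la mu i

  ins-b : InShape la mu b c
  ins-b = proj₁ b-lowest
  T-b : T b c ≡ i
  T-b = proj₁ (proj₂ b-lowest)
  below-b : ∀ r → InShape la mu r c → T r c ≡ i → r ≤ b
  below-b = proj₂ (proj₂ b-lowest)

  no-next : ¬ ColumnHas T c (suc i)
  no-next = cls⇒no-next {i} {T} {c} c-cls

  empty-below : ∀ d v → c ≤ d → (v ≡ i ⊎ v ≡ suc i) → ¬ HasFrom v d (suc b)
  empty-below d v cd hv (r , h1 , h2 , h3) with between-i-1+i (T r c) lo hi
    where
    ins = corner ins-b h2 (<⇒≤ h1) cd
    lo = ≤-trans (≤-reflexive (sym T-b)) (col-mono ins-b ins (<⇒≤ h1))
    hi = ≤-trans (row-mono ins h2 cd) (≤-trans (≤-reflexive h3) (v≤ hv))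
      where v≤ : (v ≡ i ⊎ v ≡ suc i) → v ≤ suc i
            v≤ (inj₁ refl) = n≤1+n i
            v≤ (inj₂ refl) = ≤-refl
  ... | inj₁ e = <-irrefl refl (<-≤-trans h1 (below-b r (corner ins-b h2 (<⇒≤ h1) cd) e))
  ... | inj₂ e = no-next (r , corner ins-b h2 (<⇒≤ h1) cd , e)

  touches-b : Touches c b
  touches-b = inj₂ (b , ≤-refl , ins-b , T-b)

  mixed-left-next : ∀ d → d < c → ColumnHas T d i → ColumnHas T d (suc i) → HasFrom (suc i) d b
  mixed-left-next d lt hi hn with touch-left (<⇒≤ lt) ≤-refl touches-b (inj₁ hi)
  ... | inj₁ x = x
  ... | inj₂ x = next-below hn x

  mixed-left-i : ∀ d → d < c → ColumnHas T d i → ColumnHas T d (suc i) → HasFrom i d b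
  mixed-left-i d lt (y , hy1 , hy2) hn with b ≤? y
  ... | yes le = y , le , hy1 , hy2
  ... | no nle with touches⇒band (touch-left (<⇒≤ lt) ≤-refl touches-b (inj₁ (y , hy1 , hy2)))
  ... | y' , a1 , a2 , _ , _ = b , ≤-refl , ins-bd ,
        squeeze {T y d} {T b d} {T b c} (col-mono hy1 ins-bd y≤b) (row-mono ins-bd ins-b (<⇒≤ lt)) hy2 T-b
    where
    y≤b = <⇒≤ (≰⇒> nle)
    ins-bd = column-convex hy1 a2 y≤b a1

  column-balance : ∀ d → occ (suc i) d (threshold b c d) + below c d (clsCol d) ≡ occ i d (threshold b c d) + below c d (opnCol d)
  column-balance d with d <? c
  column-balance d | no ge rewrite threshold-ge b c d (≮⇒≥ ge) | below-ge {c} {d} (clsCol d) (≮⇒≥ ge) | below-ge {c} {d} (opnCol d) (≮⇒≥ ge)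
    | occ-0 (empty-below d (suc i) (≮⇒≥ ge) (inj₂ refl)) | occ-0 (empty-below d i (≮⇒≥ ge) (inj₁ refl)) = refl
  column-balance d | yes lt rewrite threshold-lt b c d lt | below-lt {c} {d} (clsCol d) lt | below-lt {c} {d} (opnCol d) lt with columnKind i T d
  ... | i-pure e hi ¬hn rewrite e | occ-0 {suc i} {d} {b} (no-from ¬hn) with touch-left (<⇒≤ lt) ≤-refl touches-b (inj₁ hi)
  ...   | inj₁ x = ⊥-elim (no-from ¬hn x)
  ...   | inj₂ x rewrite occ-1 x = refl
  column-balance d | yes lt | next-pure e ¬hi hn rewrite e | occ-0 {i} {d} {b} (no-from ¬hi) with touch-left (<⇒≤ lt) ≤-refl touches-b (inj₂ hn)
  ...   | inj₂ x = ⊥-elim (no-from ¬hi x)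
  ...   | inj₁ x rewrite occ-1 x = refl
  column-balance d | yes lt | mixed-col e hi hn rewrite e | occ-1 (mixed-left-next d lt hi hn) | occ-1 (mixed-left-i d lt hi hn) = refl
  column-balance d | yes lt | empty-col e ¬hi ¬hn rewrite e | occ-0 {i} {d} {b} (no-from ¬hi) | occ-0 {suc i} {d} {b} (no-from ¬hn) = refl

  balance : regionCount (suc i) b c + #cls (take c cw) ≡ regionCount i b c + #opn (take c cw)
  balance = begin
    regionCount (suc i) b c + #cls (take c cw)
      ≡⟨ sym (totals (suc i) clsCol (#cls-colWord c (<⇒≤ c<W))) ⟩
    sumRange (λ d → occ (suc i) d (threshold b c d) + below c d (clsCol d)) 0 W
      ≡⟨ sumRange-cong _ _ 0 W (λ d _ _ → column-balance d) ⟩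
    sumRange (λ d → occ i d (threshold b c d) + below c d (opnCol d)) 0 W
      ≡⟨ totals i opnCol (#opn-colWord c (<⇒≤ c<W)) ⟩
    regionCount i b c + #opn (take c cw) ∎
    where
    open ≡-Reasoning
    totals : ∀ v f {n} → n ≡ sumRange f 0 c → sumRange (λ d → occ v d (threshold b c d) + below c d (f d)) 0 W ≡ regionCount v b c + n
    totals v f e = trans (sumRange-+ _ _ 0 W) (cong (regionCount v b c +_) (trans (sumRange-below f c W (<⇒≤ c<W)) (sym e)))

  private
    k = L ∸ suc b
    j₀ = c ∸ at mu b
    k+1+b : k + suc b ≡ L
    k+1+b = m∸n+n≡m (row<length ins-b)
    μ+j₀ : at mu b + j₀ ≡ c
    μ+j₀ = m+[n∸m]≡n (proj₁ ins-b)
    j₀<rowLen : j₀ < rowLen b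
    j₀<rowLen = ∸-monoˡ-< (proj₂ ins-b) (proj₁ ins-b)

  lowerRows : List ℕ
  lowerRows = readRows T (suc b) k

  leftOf rightOf : Filling → List ℕ
  leftOf X = concatMap (cellLetters X b) (range (at mu b) j₀)
  rightOf X = concatMap (cellLetters X b) (range (suc c) (rowLen b ∸ suc j₀))

  U V : List ℕ
  U = lowerRows ++ leftOf T
  V = rightOf T ++ readRows T 0 b

  reading-around : ∀ X → reading la mu X ≡ readRows X (suc b) k ++ ((leftOf X ++ (cellLetters X b c ++ rightOf X)) ++ readRows X 0 b)
  reading-around X = trans (reading-rows X) (trans (cong (readRows X 0) (sym k+1+b)) (trans (readRows-split X 0 k (suc b))
    (cong (λ z → readRows X (suc b) k ++ (z ++ readRows X 0 b)) row-b)))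
    where
    row-b : readRow la mu X b ≡ leftOf X ++ (cellLetters X b c ++ rightOf X)
    row-b = trans (readRow-cells X b) (trans (cong (concatMap (cellLetters X b)) (range-mid (at mu b) j₀ (rowLen b) j₀<rowLen))
      (trans (concatMap-++ (cellLetters X b) (range (at mu b) j₀) _)
        (cong (λ z → leftOf X ++ (cellLetters X b z ++ concatMap (cellLetters X b) (range (suc z) (rowLen b ∸ suc j₀)))) μ+j₀)))

  reading-T : reading la mu T ≡ U ++ i ∷ V
  reading-T = trans (reading-around T) (trans (cong (λ z → lowerRows ++ ((leftOf T ++ (z ++ rightOf T)) ++ readRows T 0 b)) cell-b)
    (regroup lowerRows (leftOf T) i (rightOf T) (readRows T 0 b)))
    where
    cell-b : cellLetters T b c ≡ i ∷ []
    cell-b = trans (cellLetters-kept T b c (λ ins1 e → <-irrefl refl (below-b (suc b) ins1 (trans e T-b)))) (cong (_∷ []) T-b)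

  R = raise la mu i c T

  raised-cell-other : ∀ r d → InShape la mu r d → ¬ (r ≡ b × d ≡ c) → cellLetters R r d ≡ cellLetters T r d
  raised-cell-other r d ins ne with d ≟ c
  ... | no dc = cellLetters-cong R T r d (raise-other c T r d dc) (raise-other c T (suc r) d dc)
  ... | yes refl with T r d ≟ i
  ... | yes ti =
    let r<b = ≤∧≢⇒< (below-b r ins ti) (λ e → ne (e , refl))
        ins1 = column-convex ins ins-b (n≤1+n r) r<b
        ti1 = squeeze {T r d} {T (suc r) d} {T b d} (col-mono ins ins1 (n≤1+n r)) (col-mono ins1 ins-b r<b) ti T-b
    in trans (cellLetters-skipped R r d ins1 (trans (raise-i c T (suc r) ins1 ti1) (sym (raise-i c T r ins ti))))
             (sym (cellLetters-skipped T r d ins1 (trans ti1 (sym ti))))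
  ... | no nti with inShape? {la} {mu} (suc r) d
  ... | inj₂ nins = cellLetters-cong R T r d (raise-not-i c T r nti) (raise-outside c T (suc r) nins)
  ... | inj₁ ins1 with T (suc r) d ≟ i
  ... | no nti1 = cellLetters-cong R T r d (raise-not-i c T r nti) (raise-not-i c T (suc r) nti1)
  ... | yes ti1 = trans (cellLetters-kept R r d (λ _ e → <-irrefl refl (subst (_≤ i) (trans (sym (trans e (raise-not-i c T r nti))) (raise-i c T (suc r) ins1 ti1)) (subst (T r d ≤_) ti1 (col-mono ins ins1 (n≤1+n r))))))
                    (trans (cong (_∷ []) (raise-not-i c T r nti)) (sym (cellLetters-kept T r d (λ _ e → nti (trans (sym e) ti1)))))

  raised-cell : cellLetters R b c ≡ suc i ∷ []
  raised-cell = trans (cellLetters-kept R b c kept) (cong (_∷ []) (raise-i c T b ins-b T-b))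
    where
    kept : InShape la mu (suc b) c → ¬ R (suc b) c ≡ R b c
    kept ins1 e with T (suc b) c ≟ i
    ... | yes ti = <-irrefl refl (below-b (suc b) ins1 ti)
    ... | no nti = no-next (suc b , ins1 , trans (sym (raise-not-i c T (suc b) nti)) (trans e (raise-i c T b ins-b T-b)))

  reading-raised : reading la mu R ≡ U ++ suc i ∷ V
  reading-raised = trans (reading-around R) (trans (cong₂ (λ a z → a ++ ((leftOf R ++ (z ++ rightOf R)) ++ readRows R 0 b)) lower raised-cell)
    (trans (cong₃ (λ p q z → lowerRows ++ ((p ++ (suc i ∷ [] ++ q)) ++ z)) left right upper)
      (regroup lowerRows (leftOf T) (suc i) (rightOf T) (readRows T 0 b))))
    where
    row-other : ∀ r → ¬ r ≡ b → readRow la mu R r ≡ readRow la mu T r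
    row-other r ne = readRow-cong R T r (λ d ins → raised-cell-other r d ins (λ e → ne (proj₁ e)))
    lower : readRows R (suc b) k ≡ lowerRows
    lower = readRows-cong R T (suc b) k (λ r h1 _ → row-other r (λ e → <-irrefl (sym e) h1))
    upper : readRows R 0 b ≡ readRows T 0 b
    upper = readRows-cong R T 0 b (λ r _ h2 → row-other r (λ e → <-irrefl e h2))
    left : leftOf R ≡ leftOf T
    left = concatMap-cong-range _ _ (at mu b) j₀ (λ d h1 h2 →
      raised-cell-other b d (inRow b d h1 (<-trans h2 (+-monoʳ-< (at mu b) j₀<rowLen))) (λ e → <-irrefl (proj₂ e) (subst (d <_) μ+j₀ h2)))
    end : suc c + (rowLen b ∸ suc j₀) ≡ at mu b + rowLen b
    end = trans (cong (λ z → suc z + (rowLen b ∸ suc j₀)) (sym μ+j₀)) (trans (cong (_+ (rowLen b ∸ suc j₀)) (sym (+-suc (at mu b) j₀)))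
      (trans (+-assoc (at mu b) (suc j₀) _) (cong (at mu b +_) (m+[n∸m]≡n j₀<rowLen))))
    right : rightOf R ≡ rightOf T
    right = concatMap-cong-range _ _ (suc c) (rowLen b ∸ suc j₀) (λ d h1 h2 →
      raised-cell-other b d (inRow b d (≤-trans (≤-trans (m≤m+n (at mu b) j₀) (≤-reflexive μ+j₀)) (<⇒≤ h1)) (subst (d <_) end h2))
        (λ e → <-irrefl (sym (proj₂ e)) h1))

  count-lower : ∀ v → count v lowerRows ≡ rowsCount v (suc b)
  count-lower v = trans (sym (+-identityʳ _)) (trans (cong (count v lowerRows +_) (sym (trans (cong (rowsCount v) (trans (+-comm (suc b) k) k+1+b)) (rowsCount-beyond v))))
    (rows-count v (suc b) k))

  count-U : ∀ v → count v U ≡ regionCount v b c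
  count-U v = trans (count-++ v lowerRows (leftOf T)) (trans (cong (_+ count v (leftOf T)) (count-lower v))
    (trans (+-comm (rowsCount v (suc b)) _) (trans (rowPrefix-count v b j₀ (<⇒≤ j₀<rowLen)) (cong (regionCount v b) μ+j₀))))

  prefix-U : ∀ n → Σ ℕ λ r → Σ ℕ λ q → b < threshold r q c × (∀ v → count v (take n U) ≡ regionCount v r q)
  prefix-U n with n ≤? length lowerRows
  ... | yes le with rowsPrefix-count (suc b) k n
  ... | r , q , sr , h = r , q , ≤-trans sr (threshold-≥ r q c) , λ v →
        trans (cong (count v) (take-++-≤ n lowerRows (leftOf T) le)) (trans (sym (+-identityʳ _))
          (trans (cong (count v (take n lowerRows) +_) (sym (trans (cong (rowsCount v) (trans (+-comm (suc b) k) k+1+b)) (rowsCount-beyond v)))) (h v)))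
  prefix-U n | no nle with rowPrefix-take b (n ∸ length lowerRows) j₀ (<⇒≤ j₀<rowLen)
  ... | j , j≤j₀ , tk = b , at mu b + j , subst (b <_) (sym (threshold-ge b (at mu b + j) c q≤c)) ≤-refl , λ v →
        trans (cong (count v) take-U) (trans (count-++ v lowerRows _) (trans (cong (_+ count v (concatMap (cellLetters T b) (range (at mu b) j))) (count-lower v))
          (trans (+-comm (rowsCount v (suc b)) _) (rowPrefix-count v b j (≤-trans j≤j₀ (<⇒≤ j₀<rowLen))))))
    where
    q≤c : at mu b + j ≤ c
    q≤c = subst (at mu b + j ≤_) μ+j₀ (+-monoʳ-≤ (at mu b) j≤j₀)
    take-U : take n U ≡ lowerRows ++ concatMap (cellLetters T b) (range (at mu b) j)
    take-U = trans (cong (λ z → take z U) (sym (m+[n∸m]≡n (<⇒≤ (≰⇒> nle))))) (trans (take-++-+ (n ∸ length lowerRows) lowerRows (leftOf T)) (cong (lowerRows ++_) tk))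

cancel-bound : ∀ a b x y → a + x ≤ b + y → y ≤ x → a ≤ b
cancel-bound a b x y h1 h2 = +-cancelʳ-≤ x a b (≤-trans h1 (+-monoʳ-≤ b h2))

chain-bound : ∀ a b x y X Y P Q e → a + x ≤ b + y → y + X ≤ x + (e + Y) → P + Y ≡ Q + X → a + P ≤ b + (e + Q)
chain-bound a b x y X Y P Q e h1 h2 h3 = +-cancelʳ-≤ Y (a + P) (b + (e + Q)) (subst₂ _≤_ l r (+-monoˡ-≤ Q s2))
  where
  s1 : (a + X) + (x + y) ≤ (b + (e + Y)) + (x + y)
  s1 = subst₂ _≤_ (r1 a x y X) (r2 b y x e Y) (+-mono-≤ h1 h2)
    where r1 : ∀ a x y X → (a + x) + (y + X) ≡ (a + X) + (x + y)
          r1 = solve-∀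
          r2 : ∀ b y x e Y → (b + y) + (x + (e + Y)) ≡ (b + (e + Y)) + (x + y)
          r2 = solve-∀
  s2 : a + X ≤ b + (e + Y)
  s2 = +-cancelʳ-≤ (x + y) (a + X) (b + (e + Y)) s1
  l : (a + X) + Q ≡ (a + P) + Y
  l = trans (+-assoc a X Q) (trans (cong (a +_) (trans (+-comm X Q) (sym h3))) (sym (+-assoc a P Y)))
  r : (b + (e + Y)) + Q ≡ (b + (e + Q)) + Y
  r = r4 b e Y Q
    where r4 : ∀ b e Y Q → (b + (e + Y)) + Q ≡ (b + (e + Q)) + Y
          r4 = solve-∀

Fword-nothing : ∀ i w → rightmostUnmatchedCls (map (letterParen i) w) ≡ nothing → Fword i w ≡ nothing
Fword-nothing i w e rewrite e = refl

Fword-just : ∀ i w p → rightmostUnmatchedCls (map (letterParen i) w) ≡ just p → Fword i w ≡ just (setAt p (suc i) w)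
Fword-just i w p e rewrite e = refl

setAt-mid : ∀ (U V : List ℕ) x v → setAt (length U) v (U ++ x ∷ V) ≡ U ++ v ∷ V
setAt-mid [] V x v = refl
setAt-mid (y ∷ U) V x v = cong (y ∷_) (setAt-mid U V x v)

module WordSide {la mu : List ℕ} (sh : SkewShape la mu) {m : ℕ} (i : ℕ) (T : Filling) (rpp : RPP la mu m T) where
  open ReadingWord la mu
  open PrefixCounts {la} {mu} sh {m} T rpp
  open Columns {la} {mu} sh
  open ColumnWord la mu i T
  open RegionBound {la} {mu} sh {m} i T rpp

  w = reading la mu T
  ps = map (letterParen i) w

  -- every prefix of r T has at least as many i+1's as i's when no column is
  -- an unmatched closing bracket
  F-zero : rightmostUnmatchedCls cw ≡ nothing → Fword i w ≡ nothing
  F-zero e = Fword-nothing i w (cong last (noUnmatched-from-prefixes 0 0 ps prefix))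
    where
    cw-prefix = prefixes-from-noUnmatched 0 0 cw (last-nothing _ e)
    prefix : ∀ n → #cls (take n ps) ≤ #opn (take n ps)
    prefix n with prefix-count n
    ... | r , q , h with region-bound r q
    ... | δ , _ , ineq , _ = subst₂ _≤_
          (sym (trans (cong #cls (take-map n w)) (trans (#cls-letters i (take n w)) (h i))))
          (sym (trans (cong #opn (take-map n w)) (trans (#opn-letters i (take n w)) (h (suc i)))))
          (cancel-bound _ _ _ _ ineq (cw-prefix δ))

  module AtColumn (Ucw Vcw : List Paren) (cw-split : cw ≡ Ucw ++ cls ∷ Vcw) (rightmost : RightmostSplit Ucw Vcw) where
    c = length Ucw
    c<W = proj₁ (colWord-at Ucw Vcw cls cw-split)
    c-cls = proj₂ (colWord-at Ucw Vcw cls cw-split)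
    b = lowestI i T c
    open RaisedCell {la} {mu} sh {m} i T rpp c b c<W c-cls (lowestI-spec i T c (cls⇒has-i {i} {T} {c} c-cls))

    cw-conds = SplitConditions.split⇒conds Ucw Vcw rightmost

    take-c : take c cw ≡ Ucw
    take-c = trans (cong (take c) cw-split) (trans (take-++-≤ c Ucw _ ≤-refl) (take-all c Ucw ≤-refl))

    balance-Ucw : regionCount (suc i) b c + #cls Ucw ≡ regionCount i b c + #opn Ucw
    balance-Ucw = subst (λ z → regionCount (suc i) b c + #cls z ≡ regionCount i b c + #opn z) take-c balance

    via-region : ∀ e r q (xs : List ℕ) → (∀ v → count v xs ≡ regionCount v r q) →
      (∀ δ → (∀ c' → Meets c' → ¬ Touches c' (threshold r q c') → δ ≤ c') → #cls (take δ cw) + #opn Ucw ≤ #opn (take δ cw) + (e + #cls Ucw)) →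
      count i xs + count (suc i) U ≤ count (suc i) xs + (e + count i U)
    via-region e r q xs h cw-bound with region-bound r q
    ... | δ , _ , ineq , δ-first = subst₂ _≤_ (cong₂ _+_ (sym (h i)) (sym (count-U (suc i)))) (cong₂ (λ x y → x + (e + y)) (sym (h (suc i))) (sym (count-U i)))
          (chain-bound (regionCount i r q) (regionCount (suc i) r q) (#opn (take δ cw)) (#cls (take δ cw)) (#opn Ucw) (#cls Ucw) (regionCount (suc i) b c) (regionCount i b c) e ineq (cw-bound δ δ-first) balance-Ucw)

    Up Vp : List Paren
    Up = map (letterParen i) U
    Vp = map (letterParen i) V

    ps-split : ps ≡ Up ++ cls ∷ Vp
    ps-split = trans (cong (map (letterParen i)) reading-T) (trans (map-++ (letterParen i) U (i ∷ V)) (cong (λ z → Up ++ z ∷ Vp) letter-i))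
      where letter-i : letterParen i i ≡ cls
            letter-i rewrite ≡ᵇ-true {i} {i} refl = refl

    c-untouched : ∀ t → b < t → ¬ Touches c t
    c-untouched t bt (inj₁ (r' , _ , h2 , h3)) = no-next (r' , h2 , h3)
    c-untouched t bt (inj₂ (r' , h1 , h2 , h3)) = <-irrefl refl (<-≤-trans bt (≤-trans h1 (below-b r' h2 h3)))

    before : SplitConditions.BeforeCond Up Vp
    before n le with prefix-U n
    ... | r , q , bt , h = subst₂ (λ x y → #cls x + #opn Up ≤ #opn y + #cls Up) (sym take-n) (sym take-n)
          (subst₂ _≤_ (cong₂ _+_ (sym (#cls-letters i (take n U))) (sym (#opn-letters i U))) (cong₂ _+_ (sym (#opn-letters i (take n U))) (sym (#cls-letters i U)))
            (via-region 0 r q (take n U) h (λ δ δ-first → cw-before δ (δ-first c (inj₁ (cls⇒has-i {i} {T} {c} c-cls)) (c-untouched _ bt)))))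
      where
      take-n : take n (Up ++ cls ∷ Vp) ≡ map (letterParen i) (take n U)
      take-n = trans (take-++-≤ n Up (cls ∷ Vp) le) (take-map n U)
      cw-before : ∀ δ → δ ≤ c → #cls (take δ cw) + #opn Ucw ≤ #opn (take δ cw) + #cls Ucw
      cw-before δ δ≤c = subst (λ z → #cls (take δ z) + #opn Ucw ≤ #opn (take δ z) + #cls Ucw) (sym cw-split) (proj₁ cw-conds δ δ≤c)

    after : SplitConditions.AfterCond Up Vp
    after n with prefix-count n
    ... | r , q , h = subst₂ (λ x y → #cls (take n x) + #opn Up ≤ #opn (take n y) + suc (#cls Up)) ps-split ps-split
          (subst₂ _≤_ (cong₂ _+_ (sym (trans (cong #cls (take-map n w)) (#cls-letters i (take n w)))) (sym (#opn-letters i U)))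
                      (cong₂ (λ x y → x + suc y) (sym (trans (cong #opn (take-map n w)) (#opn-letters i (take n w)))) (sym (#cls-letters i U)))
            (via-region 1 r q (take n w) h (λ δ _ → cw-after δ)))
      where
      cw-after : ∀ δ → #cls (take δ cw) + #opn Ucw ≤ #opn (take δ cw) + suc (#cls Ucw)
      cw-after δ = subst (λ z → #cls (take δ z) + #opn Ucw ≤ #opn (take δ z) + suc (#cls Ucw)) (sym cw-split) (proj₂ cw-conds δ)

    F-raise-at : Fword i w ≡ just (reading la mu (raise la mu i c T))
    F-raise-at = trans (Fword-just i w (length Up) rightmost-ps) (cong just (trans (cong₂ (λ a z → setAt a (suc i) z) (length-map _ U) reading-T)
                   (trans (setAt-mid U V i (suc i)) (sym reading-raised))))
      where
      rightmost-ps : last (unmatchedCls 0 0 ps) ≡ just (length Up)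
      rightmost-ps = trans (cong (λ z → last (unmatchedCls 0 0 z)) ps-split)
        (rightmost-at-split Up Vp (SplitConditions.conds⇒split Up Vp before after))

  F-raise : ∀ c → rightmostUnmatchedCls cw ≡ just c → Fword i w ≡ just (reading la mu (raise la mu i c T))
  F-raise c e with rightmost-split 0 0 cw c e
  ... | Ucw , Vcw , cw-split , refl , pending , unmatched = AtColumn.F-raise-at Ucw Vcw cw-split (pending , unmatched)

-- Starting from raise c T, the expected run of the
-- descent-resolution algorithm resolves the descent between columns c + k and
-- c + k + 1 by the (i+1)-pure / mixed step, giving chain k.  In chain k the
-- band cells (entries i or i + 1 of T) of columns c , ... , c + k - 1 are split
-- at the lowest i of the next column, column c + k is all i + 1, and all
-- other cells are those of T.
module ResolutionChain {la mu : List ℕ} (sh : SkewShape la mu) {m : ℕ} (i : ℕ) (T : Filling) (rpp : RPP la mu m T) (c : ℕ) where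
  open ReadingWord la mu
  open Geometry {la} {mu} sh
  open Monotone {la} {mu} sh {m} {T} rpp
  open Columns {la} {mu} sh
  open Edits la mu i

  Band : ℕ → ℕ → Set
  Band = InBandCell T

  band? : ∀ r d → Band r d ⊎ ¬ Band r d
  band? r d with inShapeᵇ la mu r d in e | T r d ≟ i | T r d ≟ suc i
  ... | false | _ | _ = inj₂ (λ h → true≢false (trans (sym (inShapeᵇ-true {la} {mu} (proj₁ h))) e))
  ... | true | yes a | _ = inj₁ (inShapeᵇ-sound {la} {mu} e , inj₁ a)
  ... | true | no _ | yes b = inj₁ (inShapeᵇ-sound {la} {mu} e , inj₂ b)
  ... | true | no a | no b = inj₂ (λ { (_ , inj₁ x) → a x ; (_ , inj₂ x) → b x })

  band-≥i : ∀ {r d} → Band r d → i ≤ T r d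
  band-≥i (_ , inj₁ e) = ≤-reflexive (sym e)
  band-≥i (_ , inj₂ e) = ≤-trans (n≤1+n i) (≤-reflexive (sym e))

  splitRow : ℕ → ℕ
  splitRow d = lowestI i T (suc d)

  chain : ℕ → Filling
  chain zero = raise la mu i c T
  chain (suc k) = setColAll la mu i (suc (c + k)) (suc i) (setColSplit la mu i (c + k) (splitRow (c + k)) (chain k))

  private
    inner : ℕ → Filling
    inner k = setColSplit la mu i (c + k) (splitRow (c + k)) (chain k)

  chain-off : ∀ k r d → ¬ Band r d → chain k r d ≡ T r d
  chain-off zero r d nb with d ≟ c
  ... | no ne = raise-other c T r d ne
  ... | yes refl with T r d ≟ i
  ... | no nti = raise-not-i d T r nti
  ... | yes ti with inShape? {la} {mu} r d
  ... | inj₁ ins = ⊥-elim (nb (ins , inj₁ ti))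
  ... | inj₂ nins = raise-outside d T r nins
  chain-off (suc k) r d nb with d ≟ suc (c + k)
  ... | yes refl = trans (setColAll-off (suc (c + k)) (suc i) (inner k) r (λ { (h1 , h2) → nb (h1 , subst (λ z → z ≡ i ⊎ z ≡ suc i) unchanged h2) })) unchanged
    where unchanged : inner k r (suc (c + k)) ≡ T r (suc (c + k))
          unchanged = trans (setColSplit-other (c + k) (splitRow (c + k)) (chain k) r _ 1+n≢n) (chain-off k r _ nb)
  ... | no ne with d ≟ c + k
  ... | yes refl = trans (setColAll-other (suc (c + k)) (suc i) (inner k) r d ne)
        (trans (setColSplit-off (c + k) (splitRow (c + k)) (chain k) r (λ { (h1 , h2) → nb (h1 , subst (λ z → z ≡ i ⊎ z ≡ suc i) (chain-off k r _ nb) h2) })) (chain-off k r _ nb))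
  ... | no ne2 = trans (setColAll-other (suc (c + k)) (suc i) (inner k) r d ne) (trans (setColSplit-other (c + k) (splitRow (c + k)) (chain k) r d ne2) (chain-off k r d nb))

  chain-left : ∀ k r d → d < c → chain k r d ≡ T r d
  chain-left zero r d h = raise-other c T r d (λ e → <-irrefl e h)
  chain-left (suc k) r d h = trans (setColAll-other (suc (c + k)) (suc i) (inner k) r d (λ e → <-irrefl refl (<-≤-trans h (≤-trans (m≤m+n c k) (≤-trans (n≤1+n _) (≤-reflexive (sym e)))))))
    (trans (setColSplit-other (c + k) (splitRow (c + k)) (chain k) r d (λ e → <-irrefl refl (<-≤-trans h (≤-trans (m≤m+n c k) (≤-reflexive (sym e)))))) (chain-left k r d h))

  chain-right : ∀ k r d → c + k < d → chain k r d ≡ T r d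
  chain-right zero r d h = raise-other c T r d (λ e → <-irrefl (sym e) (subst (_< d) (+-identityʳ c) h))
  chain-right (suc k) r d h = trans (setColAll-other (suc (c + k)) (suc i) (inner k) r d (λ e → <-irrefl (sym e) h'))
    (trans (setColSplit-other (c + k) (splitRow (c + k)) (chain k) r d (λ e → <-irrefl (sym e) (<-trans (n<1+n _) h'))) (chain-right k r d (<-trans (n<1+n _) h')))
    where h' : suc (c + k) < d
          h' = subst (_< d) (+-suc c k) h

  chain-front : ∀ k r → Band r (c + k) → chain k r (c + k) ≡ suc i
  chain-front zero r (h1 , h2) rewrite +-identityʳ c with h2
  ... | inj₁ ti = raise-i c T r h1 ti
  ... | inj₂ ti = trans (raise-not-i c T r (λ e → i≢1+i i (trans (sym e) ti))) ti
  chain-front (suc k) r (h1 , h2) rewrite +-suc c k =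
    setColAll-band (suc (c + k)) (suc i) (inner k) r (h1 , subst (λ z → z ≡ i ⊎ z ≡ suc i)
      (sym (trans (setColSplit-other (c + k) (splitRow (c + k)) (chain k) r _ 1+n≢n) (chain-right k r _ ≤-refl))) h2)

  chain-behind : ∀ k r d → c ≤ d → d < c + k → Band r d → chain k r d ≡ (if r ≤ᵇ splitRow d then i else suc i)
  chain-behind zero r d h1 h2 bd = ⊥-elim (<-irrefl refl (<-≤-trans (subst (d <_) (+-identityʳ c) h2) h1))
  chain-behind (suc k) r d h1 h2 bd with d ≟ c + k
  ... | yes refl = trans (setColAll-other (suc (c + k)) (suc i) (inner k) r (c + k) (λ e → 1+n≢n (sym e)))
        (setColSplit-band (c + k) (splitRow (c + k)) (chain k) r (proj₁ bd , inj₂ (chain-front k r bd)))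
  ... | no ne = trans (setColAll-other (suc (c + k)) (suc i) (inner k) r d (λ e → <-irrefl e d<1+c+k))
      (trans (setColSplit-other (c + k) (splitRow (c + k)) (chain k) r d ne) (chain-behind k r d h1 (≤∧≢⇒< (s≤s⁻¹ d<1+c+k) ne) bd))
    where d<1+c+k = subst (d <_) (+-suc c k) h2

  BandPreserving : Filling → Set
  BandPreserving Y = (∀ r d → Band r d → Y r d ≡ i ⊎ Y r d ≡ suc i) × (∀ r d → ¬ Band r d → Y r d ≡ T r d)

  chain-preserving : ∀ k → BandPreserving (chain k)
  chain-preserving k = in-band , chain-off k
    where
    in-band : ∀ r d → Band r d → chain k r d ≡ i ⊎ chain k r d ≡ suc i
    in-band r d bd with d <? c
    ... | yes lt rewrite chain-left k r d lt = proj₂ bd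
    ... | no nlt with d <? c + k
    ... | yes lt2 rewrite chain-behind k r d (≮⇒≥ nlt) lt2 bd = split-band _
    ... | no nlt2 with d ≟ c + k
    ... | yes refl = inj₂ (chain-front k r bd)
    ... | no ne rewrite chain-right k r d (≤∧≢⇒< (≮⇒≥ nlt2) (λ e → ne (sym e))) = proj₂ bd

  offBand-cell : ∀ Y → BandPreserving Y → ∀ r d → InShape la mu r d → ¬ Band r d → cellLetters Y r d ≡ cellLetters T r d
  offBand-cell Y (keep , fix) r d ins nb with band? (suc r) d
  ... | inj₂ nb1 = cellLetters-cong Y T r d (fix r d nb) (fix (suc r) d nb1)
  ... | inj₁ b1 = trans (cellLetters-kept Y r d (λ _ e → nb (ins , subst (λ z → z ≡ i ⊎ z ≡ suc i) (trans e (fix r d nb)) (keep (suc r) d b1))))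
      (trans (cong (_∷ []) (fix r d nb)) (sym (cellLetters-kept T r d (λ _ e → nb (ins , subst (λ z → z ≡ i ⊎ z ≡ suc i) e (proj₂ b1))))))

  -- Only row l changes: there the letter i moves from column
  -- c + k + 1 to column c + k.
  module ChainStep (k : ℕ) (mixed-B : ColumnHas T (suc (c + k)) i × ColumnHas T (suc (c + k)) (suc i))
              (r₀ : ℕ) (band₀ : Band r₀ (c + k)) (r₀≤l : r₀ ≤ splitRow (c + k)) where
    A = c + k
    B = suc (c + k)
    l = splitRow A
    Xs = chain (suc k)
    Xk = chain k

    private
      low = lowestI-spec i T B (proj₁ mixed-B)
      ins-l : InShape la mu l B
      ins-l = proj₁ low
      T-l : T l B ≡ i
      T-l = proj₁ (proj₂ low)
      below-l : ∀ r → InShape la mu r B → T r B ≡ i → r ≤ l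
      below-l = proj₂ (proj₂ low)
      z = proj₁ (proj₂ mixed-B)
      ins-z = proj₁ (proj₂ (proj₂ mixed-B))
      T-z = proj₂ (proj₂ (proj₂ mixed-B))

    l<z : l < z
    l<z with z ≤? l
    ... | yes le = ⊥-elim (<-irrefl refl (subst₂ _≤_ T-z T-l (col-mono ins-z ins-l le)))
    ... | no nle = ≰⇒> nle

    ins-l1 : InShape la mu (suc l) B
    ins-l1 = column-convex ins-l ins-z (n≤1+n l) l<z
    T-l1 : T (suc l) B ≡ suc i
    T-l1 with between-i-1+i (T (suc l) B) (≤-trans (≤-reflexive (sym T-l)) (col-mono ins-l ins-l1 (n≤1+n l))) (≤-trans (col-mono ins-l1 ins-z l<z) (≤-reflexive T-z))
    ... | inj₁ e = ⊥-elim (<-irrefl refl (below-l (suc l) ins-l1 e))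
    ... | inj₂ e = e
    ins-Al : InShape la mu l A
    ins-Al = corner (proj₁ band₀) ins-l r₀≤l (n≤1+n A)
    T-Al : T l A ≡ i
    T-Al = squeeze {i} {T l A} {T l B} (≤-trans (band-≥i band₀) (col-mono (proj₁ band₀) ins-Al r₀≤l)) (row-mono ins-Al ins-l (n≤1+n A)) refl T-l
    band-Al1 : Band (suc l) A
    band-Al1 = ins-Al1 , between-i-1+i _ (≤-trans (≤-reflexive (sym T-Al)) (col-mono ins-Al ins-Al1 (n≤1+n l))) (≤-trans (row-mono ins-Al1 ins-l1 (n≤1+n A)) (≤-reflexive T-l1))
      where ins-Al1 = corner ins-Al ins-l1 (n≤1+n l) (n≤1+n A)

    Xs-A : ∀ r → Band r A → Xs r A ≡ (if r ≤ᵇ l then i else suc i)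
    Xs-A r bd = chain-behind (suc k) r A (m≤m+n c k) (subst (A <_) (sym (+-suc c k)) (n<1+n A)) bd
    Xk-A : ∀ r → Band r A → Xk r A ≡ suc i
    Xk-A r bd = chain-front k r bd
    Xs-B : ∀ r → Band r B → Xs r B ≡ suc i
    Xs-B r bd = subst (λ d → Xs r d ≡ suc i) (+-suc c k) (chain-front (suc k) r (subst (Band r) (sym (+-suc c k)) bd))
    Xk-B : ∀ r → Xk r B ≡ T r B
    Xk-B r = chain-right k r B (n<1+n A)

    agree-A : ∀ r → l < r → Xs r A ≡ Xk r A
    agree-A r lr with band? r A
    ... | inj₁ bd = trans (Xs-A r bd) (trans (split-below (λ h → <-irrefl refl (<-≤-trans lr h))) (sym (Xk-A r bd)))
    ... | inj₂ nb = trans (chain-off (suc k) r A nb) (sym (chain-off k r A nb))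

    agree-B : ∀ r → l < r → Xs r B ≡ Xk r B
    agree-B r lr with band? r B
    ... | inj₂ nb = trans (chain-off (suc k) r B nb) (sym (chain-off k r B nb))
    ... | inj₁ (ins , inj₁ ti) = ⊥-elim (<-irrefl refl (<-≤-trans lr (below-l r ins ti)))
    ... | inj₁ bd@(_ , inj₂ ti) = trans (Xs-B r bd) (sym (trans (Xk-B r) ti))

    -- above row l both fillings skip the band cells of columns A and B
    cell-A : ∀ r → InShape la mu r A → ¬ r ≡ l → cellLetters Xs r A ≡ cellLetters Xk r A
    cell-A r ins ne with band? r A
    ... | inj₂ nb = trans (offBand-cell Xs (chain-preserving (suc k)) r A ins nb) (sym (offBand-cell Xk (chain-preserving k) r A ins nb))
    ... | inj₁ bd with r <? l
    ... | no nlt = cellLetters-cong Xs Xk r A (agree-A r lr) (agree-A (suc r) (<-trans lr (n<1+n r)))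
      where lr = ≤∧≢⇒< (≮⇒≥ nlt) (λ e → ne (sym e))
    ... | yes lt = trans (cellLetters-skipped Xs r A ins1 (trans (Xs-A (suc r) bd1) (trans (split-above lt) (sym (trans (Xs-A r bd) (split-above (<⇒≤ lt)))))))
                         (sym (cellLetters-skipped Xk r A ins1 (trans (Xk-A (suc r) bd1) (sym (Xk-A r bd)))))
      where
      ins1 = column-convex ins ins-Al (n≤1+n r) lt
      bd1 : Band (suc r) A
      bd1 = ins1 , inj₁ (squeeze {i} {T (suc r) A} {T l A} (≤-trans (band-≥i bd) (col-mono ins ins1 (n≤1+n r))) (col-mono ins1 ins-Al lt) refl T-Al)

    cell-B : ∀ r → InShape la mu r B → ¬ r ≡ l → cellLetters Xs r B ≡ cellLetters Xk r B
    cell-B r ins ne with band? r B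
    ... | inj₂ nb = trans (offBand-cell Xs (chain-preserving (suc k)) r B ins nb) (sym (offBand-cell Xk (chain-preserving k) r B ins nb))
    ... | inj₁ bd with r <? l
    ... | no nlt = cellLetters-cong Xs Xk r B (agree-B r lr) (agree-B (suc r) (<-trans lr (n<1+n r)))
      where lr = ≤∧≢⇒< (≮⇒≥ nlt) (λ e → ne (sym e))
    ... | yes lt = trans (cellLetters-skipped Xs r B ins1 (trans (Xs-B (suc r) bd1) (sym (Xs-B r bd))))
                         (sym (cellLetters-skipped Xk r B ins1 (trans (Xk-B (suc r)) (trans t1 (sym (trans (Xk-B r) t0))))))
      where
      ins1 = column-convex ins ins-l (n≤1+n r) lt
      t0 = squeeze {i} {T r B} {T l B} (band-≥i bd) (col-mono ins ins-l (<⇒≤ lt)) refl T-l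
      t1 = squeeze {i} {T (suc r) B} {T l B} (≤-trans (band-≥i bd) (col-mono ins ins1 (n≤1+n r))) (col-mono ins1 ins-l lt) refl T-l
      bd1 : Band (suc r) B
      bd1 = ins1 , inj₁ t1

    cell-other : ∀ r d → ¬ d ≡ A → ¬ d ≡ B → cellLetters Xs r d ≡ cellLetters Xk r d
    cell-other r d n1 n2 = cellLetters-cong Xs Xk r d (same r) (same (suc r))
      where same : ∀ r → Xs r d ≡ Xk r d
            same r = trans (setColAll-other B (suc i) (setColSplit la mu i A l (chain k)) r d n2) (setColSplit-other A l (chain k) r d n1)

    swap-at-l : cellLetters Xs l A ++ cellLetters Xs l B ≡ cellLetters Xk l A ++ cellLetters Xk l B
    swap-at-l = begin
      cellLetters Xs l A ++ cellLetters Xs l B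
        ≡⟨ cong₂ _++_ (cellLetters-kept Xs l A (λ _ e → i≢1+i i (trans (sym Xs-lA) (trans (sym e) Xs-l1A)))) Xs-lB ⟩
      (Xs l A ∷ []) ++ []
        ≡⟨ cong (λ z → (z ∷ []) ++ []) Xs-lA ⟩
      i ∷ []
        ≡⟨ cong (_∷ []) (sym (trans (Xk-B l) T-l)) ⟩
      [] ++ (Xk l B ∷ [])
        ≡⟨ cong₂ _++_ (sym (cellLetters-skipped Xk l A (proj₁ band-Al1) (trans (Xk-A (suc l) band-Al1) (sym (Xk-A l (ins-Al , inj₁ T-Al))))))
                      (sym (cellLetters-kept Xk l B (λ _ e → i≢1+i i (sym (trans (sym (trans (Xk-B (suc l)) T-l1)) (trans e (trans (Xk-B l) T-l))))))) ⟩
      cellLetters Xk l A ++ cellLetters Xk l B ∎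
      where
      open ≡-Reasoning
      Xs-lA : Xs l A ≡ i
      Xs-lA = trans (Xs-A l (ins-Al , inj₁ T-Al)) (split-above {l} {l} ≤-refl)
      Xs-l1A : Xs (suc l) A ≡ suc i
      Xs-l1A = trans (Xs-A (suc l) band-Al1) (split-below {suc l} {l} (λ h → <-irrefl refl h))
      Xs-lB : cellLetters Xs l B ≡ []
      Xs-lB = cellLetters-skipped Xs l B ins-l1 (trans (Xs-B (suc l) (ins-l1 , inj₂ T-l1)) (sym (Xs-B l (ins-l , inj₁ T-l))))

    row-same : ∀ r → readRow la mu Xs r ≡ readRow la mu Xk r
    row-same r with r ≟ l
    ... | no ne = readRow-cong Xs Xk r (λ d ins → case d ≟ A of λ where
            (yes refl) → cell-A r ins ne
            (no n1) → case d ≟ B of λ where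
              (yes refl) → cell-B r ins ne
              (no n2) → cell-other r d n1 n2)
    ... | yes refl = trans (readRow-cells Xs l) (trans (concatMap-swap (cellLetters Xs l) (cellLetters Xk l) (at mu l) (rowLen l) A (proj₁ ins-Al)
           (<-≤-trans (proj₂ ins-l) (m≤n+m∸n (at la l) (at mu l)))
           (λ x _ _ n1 n2 → cell-other l x n1 n2) swap-at-l) (sym (readRow-cells Xk l)))

    reading-same : reading la mu Xs ≡ reading la mu Xk
    reading-same = trans (reading-rows Xs) (trans (readRows-cong Xs Xk 0 L (λ r _ _ → row-same r)) (sym (reading-rows Xk)))

unmatched-after-nons : ∀ (f : ℕ → Paren) a n p k → k < n → (∀ j → j < k → f (a + j) ≡ non) → f (a + k) ≡ cls →
  ¬ unmatchedCls 0 p (map f (range a n)) ≡ []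
unmatched-after-nons f a (suc n) p zero _ _ fk rewrite subst (λ z → f z ≡ cls) (+-identityʳ a) fk = λ ()
unmatched-after-nons f a (suc n) p (suc k) (s≤s k<n) nons fk rewrite subst (λ z → f z ≡ non) (+-identityʳ a) (nons 0 (s≤s z≤n)) =
  unmatched-after-nons f (suc a) n (suc p) k k<n (λ j j<k → subst (λ z → f z ≡ non) (+-suc a j) (nons (suc j) (s≤s j<k))) (subst (λ z → f z ≡ cls) (+-suc a k) fk)

not-true : ∀ {b} → not b ≡ true → b ≡ false
not-true {false} e = refl

-- The columns c + 1 , c + 2 , ... up to
-- the first non-mixed one cannot be i-pure (their brackets would be
-- unmatched), so every run of the algorithm follows the resolution chain, and
-- the chain reaches a filling without descents.
module Resolution {la mu : List ℕ} (sh : SkewShape la mu) {m : ℕ} (i : ℕ) (T : Filling) (rpp : RPP la mu m T)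
                  (c : ℕ) (hc : rightmostUnmatchedCls (colWord la mu i T) ≡ just c) where
  open ReadingWord la mu
  open Geometry {la} {mu} sh
  open Monotone {la} {mu} sh {m} {T} rpp
  open Columns {la} {mu} sh
  open ColumnWord la mu i T
  open Edits la mu i
  open ResolutionChain {la} {mu} sh {m} i T rpp c

  right-of-c : unmatchedCls 0 (suc c) (map (colParen la mu i T) (range (suc c) (W ∸ suc c))) ≡ []
  right-of-c with rightmost-split 0 0 cw c hc
  ... | U , V , split , refl , _ , none = subst (λ z → unmatchedCls 0 (suc (length U)) z ≡ [])
        (trans (sym (drop-after U)) (trans (cong (drop (suc (length U))) (sym split)) (colWord-drop (suc (length U))))) none
    where drop-after : ∀ (U : List Paren) {V} → drop (suc (length U)) (U ++ cls ∷ V) ≡ V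
          drop-after [] = refl
          drop-after (_ ∷ U) = drop-after U

  Mixed : ℕ → Set
  Mixed d = ColumnHas T d i × ColumnHas T d (suc i)

  MixedRun : ℕ → Set
  MixedRun k = ∀ j → j < k → Mixed (suc (c + j))

  extend-run : ∀ {k} → MixedRun k → Mixed (suc (c + k)) → MixedRun (suc k)
  extend-run {k} run mB j j<1+k with j ≟ k
  ... | yes refl = mB
  ... | no ne = run j (≤∧≢⇒< (s≤s⁻¹ j<1+k) ne)

  run-member : ∀ {k} → MixedRun k → ∀ d → c < d → d ≤ c + k → Mixed d
  run-member {k} run d c<d d≤ = subst Mixed (m+[n∸m]≡n c<d) (run j (+-cancelˡ-≤ c (suc j) k (subst (_≤ c + k) (trans (sym (m+[n∸m]≡n c<d)) (sym (+-suc c j))) d≤)))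
    where j = d ∸ suc c

  mixed⇒non : ∀ d → Mixed d → colParen la mu i T d ≡ non
  mixed⇒non d (a , b) with columnKind i T d
  ... | i-pure _ _ nb = ⊥-elim (nb b)
  ... | next-pure _ na _ = ⊥-elim (na a)
  ... | mixed-col e _ _ = e
  ... | empty-col _ na _ = ⊥-elim (na a)

  next-mixed : ∀ k → MixedRun k → ∀ r → InShape la mu r (suc (c + k)) → T r (suc (c + k)) ≡ i → Mixed (suc (c + k))
  next-mixed k run r ins ti with columnKind i T (suc (c + k))
  ... | i-pure e _ _ = ⊥-elim (unmatched-after-nons (colParen la mu i T) (suc c) (W ∸ suc c) (suc c) k k<n
          (λ j j<k → mixed⇒non _ (run j j<k)) e right-of-c)
    where k<n : k < W ∸ suc c
          k<n = m+n≤o⇒m≤o∸n (suc k) (subst (_≤ W) (cong suc (trans (cong suc (+-comm c k)) (sym (+-suc k c)))) (col<width ins))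
  ... | next-pure _ na _ = ⊥-elim (na (r , ins , ti))
  ... | mixed-col _ a b = a , b
  ... | empty-col _ na _ = ⊥-elim (na (r , ins , ti))

  band-of : ∀ k r d v → InShape la mu r d → chain k r d ≡ v → (v ≡ i ⊎ v ≡ suc i) → Band r d
  band-of k r d v ins e hv with band? r d
  ... | inj₁ bd = bd
  ... | inj₂ nb = ⊥-elim (nb (ins , subst (λ z → z ≡ i ⊎ z ≡ suc i) (sym (trans (sym (chain-off k r d nb)) e)) hv))

  front-no-i : ∀ k → ¬ ColumnHas (chain k) (c + k) i
  front-no-i k (r , ins , e) = i≢1+i i (trans (sym e) (chain-front k r (band-of k r (c + k) i ins e (inj₁ refl))))

  T-no-descent : ∀ r A → InShape la mu r A → InShape la mu r (suc A) → T r A ≡ suc i → T r (suc A) ≡ i → ⊥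
  T-no-descent r A ins1 ins2 e1 e2 = <-irrefl refl (subst₂ _≤_ e1 e2 (row-mono ins1 ins2 (n≤1+n A)))

  -- no descent between two split columns: the split rows decrease to the right
  no-descent-behind : ∀ k → MixedRun k → ∀ r A → c ≤ A → suc A < c + k → IsDescent la mu i (chain k) r A → ⊥
  no-descent-behind k run r A c≤A 1+A<c+k (ins1 , ins2 , e1 , e2) = r≰lA (≤-trans r≤lB (below-lA lB ins-lB-A T-lB-A))
    where
    bd1 = band-of k r A (suc i) ins1 e1 (inj₂ refl)
    bd2 = band-of k r (suc A) i ins2 e2 (inj₁ refl)
    r≰lA = split-next⇒below r (splitRow A) (trans (sym (chain-behind k r A c≤A (<-trans (n<1+n A) 1+A<c+k) bd1)) e1)
    r≤lB = split-i⇒above r (splitRow (suc A)) (trans (sym (chain-behind k r (suc A) (≤-trans c≤A (n≤1+n A)) 1+A<c+k bd2)) e2)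
    below-lA = proj₂ (proj₂ (lowestI-spec i T (suc A) (proj₁ (run-member run (suc A) (s≤s c≤A) (<⇒≤ 1+A<c+k)))))
    lowB = lowestI-spec i T (suc (suc A)) (proj₁ (run-member run (suc (suc A)) (s≤s (≤-trans c≤A (n≤1+n A))) 1+A<c+k))
    lB = splitRow (suc A)
    ins-lB-A = corner ins2 (proj₁ lowB) r≤lB (n≤1+n (suc A))
    T-lB-A = squeeze {i} {T lB (suc A)} {T lB (suc (suc A))} (≤-trans (band-≥i bd2) (col-mono ins2 ins-lB-A r≤lB)) (row-mono ins-lB-A (proj₁ lowB) (n≤1+n (suc A))) refl (proj₁ (proj₂ lowB))

  no-descent-entering : ∀ k → MixedRun k → ∀ r A → suc A ≡ c → 0 < k → IsDescent la mu i (chain k) r A → ⊥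
  no-descent-entering k run r A refl 0<k (ins1 , ins2 , e1 , e2) =
    <-irrefl refl (subst₂ _≤_ t1 (proj₁ (proj₂ low)) (≤-trans (col-mono ins1 ins-l (r≤l)) (row-mono ins-l (proj₁ low) (≤-trans (n≤1+n A) (n≤1+n (suc A))))))
    where
    bd2 = band-of k r (suc A) i ins2 e2 (inj₁ refl)
    r≤l = split-i⇒above r (splitRow (suc A)) (trans (sym (chain-behind k r (suc A) ≤-refl (m<m+n (suc A) 0<k) bd2)) e2)
    low = lowestI-spec i T (suc (suc A)) (proj₁ (subst Mixed (cong suc (+-identityʳ (suc A))) (run 0 0<k)))
    ins-l = corner ins1 (proj₁ low) r≤l (≤-trans (n≤1+n A) (n≤1+n (suc A)))
    t1 = trans (sym (chain-left k r A (n<1+n A))) e1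

  descent-at-front : ∀ k → MixedRun k → ∀ r A → IsDescent la mu i (chain k) r A → A ≡ c + k
  descent-at-front k run r A d@(ins1 , ins2 , e1 , e2) with <-cmp A (c + k)
  ... | tri≈ _ eq _ = eq
  ... | tri> _ _ gt = ⊥-elim (T-no-descent r A ins1 ins2 (trans (sym (chain-right k r A gt)) e1) (trans (sym (chain-right k r (suc A) (<-trans gt (n<1+n A)))) e2))
  ... | tri< lt _ _ with suc A ≟ c + k
  ...   | yes front = ⊥-elim (i≢1+i i (trans (sym e2) (subst (λ z → chain k r z ≡ suc i) (sym front) (chain-front k r (subst (Band r) front (band-of k r (suc A) i ins2 e2 (inj₁ refl)))))))
  ...   | no ne with c ≤? A
  ...     | yes c≤A = ⊥-elim (no-descent-behind k run r A c≤A (≤∧≢⇒< lt ne) d)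
  ...     | no A<c with suc A ≟ c
  ...       | yes entering = ⊥-elim (no-descent-entering k run r A entering (+-cancelˡ-< c 0 k (subst (_< c + k) (trans entering (sym (+-identityʳ c))) (≤∧≢⇒< lt ne))) d)
  ...       | no ne' = ⊥-elim (T-no-descent r A ins1 ins2 (trans (sym (chain-left k r A (<-trans (n<1+n A) 1+A<c))) e1) (trans (sym (chain-left k r (suc A) 1+A<c)) e2))
    where 1+A<c = ≤∧≢⇒< (≰⇒> A<c) ne'

  _≐_ : Filling → Filling → Set
  X ≐ Y = ∀ r d → X r d ≡ Y r d

  descent-transport : ∀ {X Y r A} → X ≐ Y → IsDescent la mu i X r A → IsDescent la mu i Y r A
  descent-transport {r = r} {A} eq (ins1 , ins2 , e1 , e2) = ins1 , ins2 , trans (sym (eq r A)) e1 , trans (sym (eq r (suc A))) e2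

  lowest-eq : ∀ k Y → Y ≐ chain k → ∀ l → LowestI la mu i Y (suc (c + k)) l → Mixed (suc (c + k)) → l ≡ splitRow (c + k)
  lowest-eq k Y eq l (ins-l , Y-l , max-l) mB = ≤-antisym (proj₂ (proj₂ low) l ins-l T-l) (max-l _ (proj₁ low) (trans (eq _ _) (trans (chain-right k _ _ (n<1+n _)) (proj₁ (proj₂ low)))))
    where
    low = lowestI-spec i T (suc (c + k)) (proj₁ mB)
    T-l = trans (sym (trans (eq l _) (chain-right k l _ (n<1+n _)))) Y-l

  step-follows-chain : ∀ k Y Y' → Y ≐ chain k → MixedRun k → Step la mu i Y Y' →
    (Y' ≐ chain (suc k)) × MixedRun (suc k) × reading la mu Y' ≡ reading la mu Y
  step-follows-chain k Y Y' eq run (mixed-ipure r A l d mA _ _) with descent-at-front k run r A (descent-transport eq d)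
  ... | refl with hasVal-sound Y (c + k) i (∧-elimˡ mA)
  ... | r' , ins' , e' = ⊥-elim (front-no-i k (r' , ins' , trans (sym (eq r' (c + k))) e'))
  step-follows-chain k Y Y' eq run (opure-ipure r A d _ ipB) with descent-at-front k run r A (descent-transport eq d)
  ... | refl = ⊥-elim (true≢false (trans (sym (hasVal-true Y (suc (c + k)) (suc i) (z , ins-z , trans (eq _ _) (trans (chain-right k z _ (n<1+n _)) T-z))))
                 (not-true (∧-elimʳ {hasVal la mu Y (suc (c + k)) i} ipB))))
    where
    d' = descent-transport eq d
    mB = next-mixed k run r (proj₁ (proj₂ d')) (trans (sym (chain-right k r _ (n<1+n _))) (proj₂ (proj₂ (proj₂ d'))))
    z = proj₁ (proj₂ mB)
    ins-z = proj₁ (proj₂ (proj₂ mB))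
    T-z = proj₂ (proj₂ (proj₂ mB))
  step-follows-chain k Y Y' eq run (opure-mixed r A l d _ _ lowB) with descent-at-front k run r A (descent-transport eq d)
  ... | refl = same , extend-run run mB , reading-eq
    where
    d' = descent-transport eq d
    ins2 = proj₁ (proj₂ d')
    T-rB : T r (suc (c + k)) ≡ i
    T-rB = trans (sym (chain-right k r _ (n<1+n _))) (proj₂ (proj₂ (proj₂ d')))
    mB = next-mixed k run r ins2 T-rB
    same : setColAll la mu i (suc (c + k)) (suc i) (setColSplit la mu i (c + k) l Y) ≐ chain (suc k)
    same r' d rewrite lowest-eq k Y eq l lowB mB = setColAll-cong (suc (c + k)) (suc i) _ _ (setColSplit-cong (c + k) (splitRow (c + k)) Y (chain k) eq) r' d
    band₀ : Band r (c + k)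
    band₀ = band-of k r (c + k) (suc i) (proj₁ d') (proj₁ (proj₂ (proj₂ d'))) (inj₂ refl)
    r≤l : r ≤ splitRow (c + k)
    r≤l = proj₂ (proj₂ (lowestI-spec i T (suc (c + k)) (proj₁ mB))) r ins2 T-rB
    reading-eq = trans (reading-cong _ (chain (suc k)) same) (trans (ChainStep.reading-same k mB r band₀ r≤l) (sym (reading-cong Y (chain k) eq)))

  run-reading : ∀ k Y T' → Y ≐ chain k → MixedRun k → Star (Step la mu i) Y T' → reading la mu T' ≡ reading la mu Y
  run-reading k Y .Y eq run ε = refl
  run-reading k Y T' eq run (_◅_ {j = Y'} s rest) with step-follows-chain k Y Y' eq run s
  ... | eq' , run' , rd = trans (run-reading (suc k) Y' T' eq' run' rest) rd

  frontDescentᵇ : ℕ → ℕ → Bool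
  frontDescentᵇ k r = inShapeᵇ la mu r (c + k) ∧ (inShapeᵇ la mu r (suc (c + k)) ∧ ((chain k r (c + k) ≡ᵇ suc i) ∧ (chain k r (suc (c + k)) ≡ᵇ i)))

  front-descent? : ∀ k → (Σ ℕ λ r → IsDescent la mu i (chain k) r (c + k)) ⊎ (∀ r → ¬ IsDescent la mu i (chain k) r (c + k))
  front-descent? k with any (frontDescentᵇ k) (range 0 L) in e
  ... | true with any-range-sound (frontDescentᵇ k) 0 L e
  ...   | r , _ , _ , h = inj₁ (r , inShapeᵇ-sound {la} {mu} (∧-elimˡ h) , inShapeᵇ-sound {la} {mu} (∧-elimˡ (∧-elimʳ {inShapeᵇ la mu r (c + k)} h)) ,
          ≡ᵇ-sound (∧-elimˡ (∧-elimʳ {inShapeᵇ la mu r (suc (c + k))} (∧-elimʳ {inShapeᵇ la mu r (c + k)} h))) ,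
          ≡ᵇ-sound (∧-elimʳ {chain k r (c + k) ≡ᵇ suc i} (∧-elimʳ {inShapeᵇ la mu r (suc (c + k))} (∧-elimʳ {inShapeᵇ la mu r (c + k)} h))))
  front-descent? k | false = inj₂ λ r (i1 , i2 , e1 , e2) → true≢false (trans (sym (any-range-true (frontDescentᵇ k) 0 L r z≤n (row<length i1)
         (∧-intro (inShapeᵇ-true {la} {mu} i1) (∧-intro (inShapeᵇ-true {la} {mu} i2) (∧-intro (≡ᵇ-true e1) (≡ᵇ-true e2)))))) e)

  front-step : ∀ k → MixedRun k → ∀ r → IsDescent la mu i (chain k) r (c + k) →
    Step la mu i (chain k) (chain (suc k)) × MixedRun (suc k) × suc (c + k) < W
  front-step k run r d@(ins1 , ins2 , e1 , e2) = opure-mixed r (c + k) (splitRow (c + k)) d next-pure-A mixed-B lowest-B , extend-run run mB , col<width ins2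
    where
    B = suc (c + k)
    mB = next-mixed k run r ins2 (trans (sym (chain-right k r B (n<1+n _))) e2)
    has-B : ∀ v → ColumnHas T B v → hasVal la mu (chain k) B v ≡ true
    has-B v (y , h1 , h2) = hasVal-true (chain k) B v (y , h1 , trans (chain-right k y B (n<1+n _)) h2)
    next-pure-A : opPure la mu i (chain k) (c + k) ≡ true
    next-pure-A rewrite hasVal-false (chain k) (c + k) i (front-no-i k) | hasVal-true (chain k) (c + k) (suc i) (r , ins1 , e1) = refl
    mixed-B : mixed la mu i (chain k) B ≡ true
    mixed-B rewrite has-B i (proj₁ mB) | has-B (suc i) (proj₂ mB) = refl
    low = lowestI-spec i T B (proj₁ mB)
    lowest-B : LowestI la mu i (chain k) B (splitRow (c + k))
    lowest-B = proj₁ low , trans (chain-right k _ B (n<1+n _)) (proj₁ (proj₂ low)) , λ r' h1 h2 → proj₂ (proj₂ low) r' h1 (trans (sym (chain-right k r' B (n<1+n _))) h2)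

  -- with fuel f bounding the remaining columns, the chain reaches a filling without descents
  resolve : ∀ f k → W ≤ c + k + f → MixedRun k → Σ Filling λ T' → Star (Step la mu i) (chain k) T' × NoDescent la mu i T'
  resolve f k bound run with front-descent? k
  ... | inj₂ none = chain k , ε , λ r A d → none r (subst (IsDescent la mu i (chain k) r) (descent-at-front k run r A d) d)
  resolve zero k bound run | inj₁ (r , d) = ⊥-elim (<-irrefl refl (<-≤-trans (proj₂ (proj₂ (front-step k run r d))) (≤-trans bound (≤-trans (≤-reflexive (+-identityʳ _)) (n≤1+n _)))))
  resolve (suc f) k bound run | inj₁ (r , d) with front-step k run r d
  ... | step , run' , _ with resolve f (suc k) (subst (W ≤_) (trans (+-suc (c + k) f) (cong (_+ f) (sym (+-suc c k)))) bound) run'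
  ... | T' , steps , done = T' , step ◅ steps , done

  resolution : Σ Filling λ T' → Star (Step la mu i) (raise la mu i c T) T' × NoDescent la mu i T'
  resolution = resolve W 0 (m≤n+m W (c + 0)) (λ j ())

  run-reading-raise : ∀ T' → Star (Step la mu i) (raise la mu i c T) T' → reading la mu T' ≡ reading la mu (raise la mu i c T)
  run-reading-raise T' steps = run-reading 0 (raise la mu i c T) T' (λ _ _ → refl) (λ j ()) steps

lemma2p2 : (la mu : List ℕ) (m i : ℕ) (T : Filling) →
    SkewShape la mu → 1 ≤ m → 1 ≤ i → i < m → RPP la mu m T →
    (∃ λ res → FRes la mu i T res) ×
    (∀ res → FRes la mu i T res →
      Data.Maybe.map (reading la mu) res ≡ Fword i (reading la mu T))
lemma2p2 la mu m i T sh _ _ _ rpp = exists , commutes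
  where
  open WordSide {la} {mu} sh {m} i T rpp using (F-zero; F-raise)

  exists : ∃ λ res → FRes la mu i T res
  exists with rightmostUnmatchedCls (colWord la mu i T) in e
  ... | nothing = nothing , f-zero e
  ... | just c with Resolution.resolution {la} {mu} sh {m} i T rpp c e
  ...   | T' , steps , done = just T' , f-some c T' e steps done

  commutes : ∀ res → FRes la mu i T res → Data.Maybe.map (reading la mu) res ≡ Fword i (reading la mu T)
  commutes .nothing (f-zero e) = sym (F-zero e)
  commutes .(just T') (f-some c T' e steps _) =
    trans (cong just (Resolution.run-reading-raise {la} {mu} sh {m} i T rpp c e T' steps)) (sym (F-raise c e))
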